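{- Let $(G,\mathbf{A})$ be a weighted bipartite torus graph whose associated quiver $\mathcal{Q}_G$ has no 1-cycles, and let $k$ be a quadrilateral face of $G$ whose four sides are distinct. Let $k_1,k_2,k_3,k_4$ be the faces lying across the four sides of $k$, listed in cyclic order around $k$, and suppose $k_i\neq k_{i+1}$ for all $i$ (indices read modulo $4$; opposite faces $k_1,k_3$ or $k_2,k_4$ may coincide). Then the mutation $\mu_k$ of the weighted graph $(G,\mathbf{A})$ is equivalent to the cluster mutation $\mu_k$ of the seed $(\mathbf{A},\mathcal{Q}_G)$: that is, $\mathcal{Q}_{\mu_k(G)}=\mu_k(\mathcal{Q}_G)$, and the face weights of $\mu_k(G)$ are obtained from $\mathbf{A}$ by the cluster mutation in direction $k$ with respect to the quiver $\mathcal{Q}_G$.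
   Context: A torus graph is a graph embedded without crossings in the torus $\mathbb{T}=\mathbb{R}^2/\mathbb{Z}^2$ (faces need not be contractible). It is bipartite if its vertices are colored black and white so that every edge joins vertices of different colors. A weighted bipartite torus graph $(G,\mathbf{A})$ has its faces labeled $1,\dots,n$ and carries a nonzero weight $A_i$ on each face $i$. The quiver $\mathcal{Q}_G$ has one node for each face of $G$; for each edge $e$ of $G$ separating faces $i$ and $j$ there is one arrow between nodes $i$ and $j$, crossing $e$ and oriented so that the black endpoint of $e$ lies on the right of the arrow; afterwards oriented 2-cycles are removed one at a time until none remain (1-cycles, coming from edges with the same face on both sides, may remain). Urban renewal at a quadrilateral face $k$ with four distinct sides: let $u_1,u_2,u_3,u_4$ be the corners of $k$ in cyclic order (alternating colors). Delete the four sides of $k$; add four new vertices $u_1',\dots,u_4'$ inside $k$, with $u_i'$ colored opposite to $u_i$; add edges $u_iu_i'$ and $u_i'u_{i+1}'$ (indices mod 4). The new inner quadrilateral is the new face $k$; the face formerly across side $u_iu_{i+1}$ now contains the region bounded by $u_iu_i'$, $u_i'u_{i+1}'$, $u_{i+1}'u_{i+1}$, and keeps its label. Weights change by $A_k'=(A_{k_1}A_{k_3}+A_{k_2}A_{k_4})/A_k$, all other $A_\ell$ unchanged. Shrinking a 2-valent vertex $v$: delete $v$ and its two edges and identify its two neighbours into a single vertex; weights unchanged. The mutation $\mu_k$ of a weighted bipartite graph at a quadrilateral face $k$ is an urban renewal at $k$ followed by shrinking all 2-valent vertices. Cluster mutation of a seed $(\mathbf{A},\mathcal{Q})$ in direction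 $k$ ($\mathcal{Q}$ without 1- and 2-cycles): $A_k'=A_k^{ -1}\big(\prod_{j\to k}A_j+\prod_{k\to j}A_j\big)$ (products over arrows, with multiplicity), $A_i'=A_i$ for $i\ne k$. Quiver mutation at $k$: reverse all arrows at $k$; for each pair of arrows $i\to k\to j$ add an arrow $i\to j$; then remove oriented 2-cycles one by one. -}

module Defs where

open import Level using (Level; _⊔_) renaming (suc to lsuc)
open import Algebra.Bundles using (CommutativeRing)
open import Data.Nat using (ℕ; zero; suc; _∸_; _≤ᵇ_)
import Data.Nat as ℕ
open import Data.Fin using (Fin; toℕ; _↑ˡ_; _↑ʳ_; splitAt; #_)
import Data.Fin as Fin
open import Data.Fin.Properties using (_≟_)
open import Data.Bool using (Bool; true; false; if_then_else_; _∧_; _∨_; not; T)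
open import Data.Sum using (_⊎_; inj₁; inj₂)
open import Data.Product using (Σ; _×_; _,_; ∃)
open import Relation.Nullary using (¬_)
open import Relation.Nullary.Decidable using (⌊_⌋)
open import Relation.Binary.PropositionalEquality using (_≡_; _≢_)

record Field (c ℓ : Level) : Set (lsuc (c ⊔ ℓ)) where
  field
    commutativeRing : CommutativeRing c ℓ
  open CommutativeRing commutativeRing public
  field
    0≉1     : ¬ (0# ≈ 1#)
    inv     : (x : Carrier) → ¬ (x ≈ 0#) → Carrier
    inverse : (x : Carrier) (nz : ¬ (x ≈ 0#)) → (x * inv x nz) ≈ 1#

  div : (a b : Carrier) → ¬ (b ≈ 0#) → Carrier
  div a b nz = a * inv b nz

  pow : Carrier → ℕ → Carrier
  pow x zero    = 1#
  pow x (suc m) = x * pow x m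

  prodᶠ : ∀ {n} → (Fin n → Carrier) → Carrier
  prodᶠ {zero}  f = 1#
  prodᶠ {suc n} f = f Fin.zero * prodᶠ (λ i → f (Fin.suc i))

_==_ : ∀ {m} → Fin m → Fin m → Bool
x == y = ⌊ x ≟ y ⌋

count : ∀ {m} → (Fin m → Bool) → ℕ
count {zero}  p = 0
count {suc m} p = (if p Fin.zero then 1 else 0) ℕ.+ count (λ i → p (Fin.suc i))

allᶠ : ∀ {m} → (Fin m → Bool) → Bool
allᶠ {zero}  p = true
allᶠ {suc m} p = p Fin.zero ∧ allᶠ (λ i → p (Fin.suc i))

sumᶠ : ∀ {m} → (Fin m → ℕ) → ℕ
sumᶠ {zero}  f = 0
sumᶠ {suc m} f = f Fin.zero ℕ.+ sumᶠ (λ i → f (Fin.suc i))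

iter : ∀ {A : Set} → (A → A) → ℕ → A → A
iter f zero    x = x
iter f (suc j) x = f (iter f j x)

-- Bipartite graphs embedded in an oriented surface, as combinatorial
-- maps (rotation systems) on the edges, with labelled faces.
--
-- Edges are the indices e : Fin M with  live e ≡ true  (the other
-- indices are unused slots; this lets deletions keep the index set).
-- Every edge e has a black end and a white end.
--   σ e : next edge counterclockwise around the black end of e
--   τ e : next edge counterclockwise around the white end of e
-- Black vertices = cycles of σ, white vertices = cycles of τ.
--   lf e : label of the face on the LEFT of e, oriented black → white.
-- The face on the right of e is  lf (τ e)  (see rf below).
-- The boundary components ("boundary walks") of faces are the cycles of
-- τ ∘ σ (inverse of the face permutation σ⁻¹ ∘ τ⁻¹); a face may have
-- several boundary components (faces need not be contractible).

record BGraph (n : ℕ) : Set where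
  field
    M    : ℕ
    live : Fin M → Bool
    σ    : Fin M → Fin M
    τ    : Fin M → Fin M
    lf   : Fin M → Fin n

module _ {n : ℕ} (G : BGraph n) where
  open BGraph G

  rf : Fin M → Fin n
  rf e = lf (τ e)

  liveCount : ℕ
  liveCount = count live

  -- number of cycles of a permutation π of the live edges:
  -- number of live e that are minimal (in Fin order) in their π-orbit
  cycles : (Fin M → Fin M) → ℕ
  cycles π = count (λ e → live e ∧ allᶠ {M} (λ j → toℕ e ≤ᵇ toℕ (iter π (toℕ j) e)))

  data Reach : Fin M → Fin M → Set where
    here    : ∀ {e} → Reach e e
    viaσ    : ∀ {e e'} → Reach e e' → Reach e (σ e')
    viaτ    : ∀ {e e'} → Reach e e' → Reach e (τ e')
    viaFace : ∀ {e e' e''} → T (live e'') → lf e'' ≡ lf e' → Reach e e' → Reach e e''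

  -- G, with face i carrying a surface of genus (genus i), is a graph
  -- embedded in the torus: a well-formed rotation system, the faces are
  -- connected orientable surfaces glued along the boundary walks, the
  -- resulting closed surface is connected and has Euler characteristic
  --   V - E + Σ_faces (2 - 2 g_f - b_f) = 0.
  record IsTorusGraph (genus : Fin n → ℕ) : Set where
    field
      σ-live  : ∀ e → T (live e) → T (live (σ e))
      τ-live  : ∀ e → T (live e) → T (live (τ e))
      σ-inj   : ∀ e e' → T (live e) → T (live e') → σ e ≡ σ e' → e ≡ e'
      τ-inj   : ∀ e e' → T (live e) → T (live e') → τ e ≡ τ e' → e ≡ e'
      faceWalk  : ∀ e → T (live e) → lf (τ (σ e)) ≡ lf e
      faceUsed  : ∀ (i : Fin n) → Σ (Fin M) (λ e → T (live e) × lf e ≡ i)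
      connected : ∀ e e' → T (live e) → T (live e') → Reach e e'
      euler     : cycles σ ℕ.+ cycles τ ℕ.+ 2 ℕ.* n
                  ≡ liveCount ℕ.+ cycles (λ e → τ (σ e)) ℕ.+ 2 ℕ.* sumᶠ genus

  -- Face k is a quadrilateral (a disc whose boundary walk has length 4)
  -- with four distinct sides s₁ s₂ s₃ s₄ in counterclockwise order and
  -- corners u₁ (black, s₄∩s₁), u₂ (white, s₁∩s₂), u₃ (black, s₂∩s₃),
  -- u₄ (white, s₃∩s₄).  k lies on the left of s₁, s₃ and on the right
  -- of s₂, s₄.
  record IsQuadFace (genus : Fin n → ℕ) (k : Fin n) (s₁ s₂ s₃ s₄ : Fin M) : Set where
    field
      live₁ : T (live s₁)
      live₂ : T (live s₂)
      live₃ : T (live s₃)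
      live₄ : T (live s₄)
      s₁≢s₂ : s₁ ≢ s₂
      s₁≢s₃ : s₁ ≢ s₃
      s₁≢s₄ : s₁ ≢ s₄
      s₂≢s₃ : s₂ ≢ s₃
      s₂≢s₄ : s₂ ≢ s₄
      s₃≢s₄ : s₃ ≢ s₄
      left₁ : lf s₁ ≡ k
      left₃ : lf s₃ ≡ k
      at-u₁ : σ s₁ ≡ s₄
      at-u₂ : τ s₂ ≡ s₁
      at-u₃ : σ s₃ ≡ s₂
      at-u₄ : τ s₄ ≡ s₃
      onlySides : ∀ e → T (live e) → lf e ≡ k → e ≡ s₁ ⊎ e ≡ s₃
      disc  : genus k ≡ 0

  across₁ across₂ across₃ across₄ : Fin M → Fin n
  across₁ s₁ = rf s₁
  across₂ s₂ = lf s₂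
  across₃ s₃ = rf s₃
  across₄ s₄ = lf s₄

-- The quiver Q_G, after removal of oriented 2-cycles, as a matrix of
-- arrow multiplicities: every edge e gives an arrow  lf e → rf e
-- (the black end of e is then on the right of the arrow).

Quiver : ℕ → Set
Quiver n = Fin n → Fin n → ℕ

arrows : ∀ {n} → BGraph n → Fin n → Fin n → ℕ
arrows G i j = count (λ e → live e ∧ (lf e == i) ∧ (rf G e == j))
  where open BGraph G

-- removing oriented 2-cycles one at a time leaves |#(i→j) - #(j→i)|
-- arrows in the majority direction; 1-cycles (loops) stay.
removeTwoCycles : ∀ {n} → Quiver n → Quiver n
removeTwoCycles c i j = if i == j then c i i else c i j ∸ c j i

quiver : ∀ {n} → BGraph n → Quiver n
quiver G = removeTwoCycles (arrows G)

mutateQuiver : ∀ {n} → Fin n → Quiver n → Quiver n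
mutateQuiver k Q = removeTwoCycles c
  where
    c : Quiver _
    c i j = if (i == k) ∨ (j == k) then Q j i else Q i j ℕ.+ Q i k ℕ.* Q k j

-- New edges (indices M+0..M+7):
--   p₁ = u₁u₁'  p₂ = u₂'u₂  p₃ = u₃u₃'  p₄ = u₄'u₄   (spokes)
--   q₁ = u₂'u₁' q₂ = u₂'u₃' q₃ = u₄'u₃' q₄ = u₄'u₁'  (inner square)
-- (written black end first; u₁', u₃' white, u₂', u₄' black).

module _ {n : ℕ} (G : BGraph n) (k : Fin n) where
  open BGraph G

  urbanRenewal : (s₁ s₂ s₃ s₄ : Fin M) → BGraph n
  urbanRenewal s₁ s₂ s₃ s₄ = record
    { M = M ℕ.+ 8 ; live = live' ; σ = σ' ; τ = τ' ; lf = lf' }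
    where
      old : Fin M → Fin (M ℕ.+ 8)
      old e = e ↑ˡ 8
      new : Fin 8 → Fin (M ℕ.+ 8)
      new i = M ↑ʳ i
      p₁ p₂ p₃ p₄ q₁ q₂ q₃ q₄ : Fin (M ℕ.+ 8)
      p₁ = new (# 0)
      p₂ = new (# 1)
      p₃ = new (# 2)
      p₄ = new (# 3)
      q₁ = new (# 4)
      q₂ = new (# 5)
      q₃ = new (# 6)
      q₄ = new (# 7)
      isSide : Fin M → Bool
      isSide e = (e == s₁) ∨ (e == s₂) ∨ (e == s₃) ∨ (e == s₄)
      -- at black corners the consecutive sides s₁,s₄ (at u₁) resp.
      -- s₃,s₂ (at u₃) are replaced by p₁ resp. p₃
      redirB : Fin M → Fin (M ℕ.+ 8)
      redirB y = if y == s₁ then p₁ else if y == s₃ then p₃ else old y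
      -- at white corners s₂,s₁ (at u₂) resp. s₄,s₃ (at u₄) become p₂, p₄
      redirW : Fin M → Fin (M ℕ.+ 8)
      redirW y = if y == s₂ then p₂ else if y == s₄ then p₄ else old y
      k₁ k₂ k₃ k₄ : Fin n
      k₁ = across₁ G s₁
      k₂ = across₂ G s₂
      k₃ = across₃ G s₃
      k₄ = across₄ G s₄
      σN τN : Fin 8 → Fin (M ℕ.+ 8)
      σN Fin.zero = redirB (σ s₄)
      σN (Fin.suc Fin.zero) = q₂
      σN (Fin.suc (Fin.suc Fin.zero)) = redirB (σ s₂)
      σN (Fin.suc (Fin.suc (Fin.suc Fin.zero))) = q₄
      σN (Fin.suc (Fin.suc (Fin.suc (Fin.suc Fin.zero)))) = p₂
      σN (Fin.suc (Fin.suc (Fin.suc (Fin.suc (Fin.suc Fin.zero))))) = q₁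
      σN (Fin.suc (Fin.suc (Fin.suc (Fin.suc (Fin.suc (Fin.suc Fin.zero)))))) = p₄
      σN (Fin.suc (Fin.suc (Fin.suc (Fin.suc (Fin.suc (Fin.suc (Fin.suc Fin.zero))))))) = q₃
      τN Fin.zero = q₁
      τN (Fin.suc Fin.zero) = redirW (τ s₁)
      τN (Fin.suc (Fin.suc Fin.zero)) = q₃
      τN (Fin.suc (Fin.suc (Fin.suc Fin.zero))) = redirW (τ s₃)
      τN (Fin.suc (Fin.suc (Fin.suc (Fin.suc Fin.zero)))) = q₄
      τN (Fin.suc (Fin.suc (Fin.suc (Fin.suc (Fin.suc Fin.zero))))) = p₃
      τN (Fin.suc (Fin.suc (Fin.suc (Fin.suc (Fin.suc (Fin.suc Fin.zero)))))) = q₂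
      τN (Fin.suc (Fin.suc (Fin.suc (Fin.suc (Fin.suc (Fin.suc (Fin.suc Fin.zero))))))) = p₁
      lfN : Fin 8 → Fin n
      lfN Fin.zero = k₄
      lfN (Fin.suc Fin.zero) = k₂
      lfN (Fin.suc (Fin.suc Fin.zero)) = k₂
      lfN (Fin.suc (Fin.suc (Fin.suc Fin.zero))) = k₄
      lfN (Fin.suc (Fin.suc (Fin.suc (Fin.suc Fin.zero)))) = k₁
      lfN (Fin.suc (Fin.suc (Fin.suc (Fin.suc (Fin.suc Fin.zero))))) = k
      lfN (Fin.suc (Fin.suc (Fin.suc (Fin.suc (Fin.suc (Fin.suc Fin.zero)))))) = k₃
      lfN (Fin.suc (Fin.suc (Fin.suc (Fin.suc (Fin.suc (Fin.suc (Fin.suc Fin.zero))))))) = k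
      live' : Fin (M ℕ.+ 8) → Bool
      live' x with splitAt M x
      ... | inj₁ e = live e ∧ not (isSide e)
      ... | inj₂ i = true
      σ' τ' : Fin (M ℕ.+ 8) → Fin (M ℕ.+ 8)
      σ' x with splitAt M x
      ... | inj₁ e = redirB (σ e)
      ... | inj₂ i = σN i
      τ' x with splitAt M x
      ... | inj₁ e = redirW (τ e)
      ... | inj₂ i = τN i
      lf' : Fin (M ℕ.+ 8) → Fin n
      lf' x with splitAt M x
      ... | inj₁ e = lf e
      ... | inj₂ i = lfN i

module _ {n : ℕ} (G : BGraph n) where
  open BGraph G

  TwoValentBlack : Fin M → Set
  TwoValentBlack e = T (live e) × σ e ≢ e × σ (σ e) ≡ e

  TwoValentWhite : Fin M → Set
  TwoValentWhite e = T (live e) × τ e ≢ e × τ (τ e) ≡ e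

  NoTwoValent : Set
  NoTwoValent = ∀ e → ¬ TwoValentBlack e × ¬ TwoValentWhite e

  private
    swap : Fin M → Fin M → Fin M → Fin M
    swap a b x = if x == a then b else if x == b then a else x

    skip : (Fin M → Bool) → (Fin M → Fin M) → ℕ → Fin M → Fin M
    skip L ρ zero    x = ρ x
    skip L ρ (suc f) x = if L (ρ x) then ρ x else skip L ρ f (ρ x)

  -- delete the black end v of e (edges e, σ e) and identify the two
  -- white neighbours: their rotations are spliced together
  -- (new τ = τ ∘ (e σe) with e, σ e removed).
  shrinkBlack : Fin M → BGraph n
  shrinkBlack e = record
    { M = M ; live = live' ; σ = σ
    ; τ = skip live' (λ x → τ (swap e (σ e) x)) M ; lf = lf }
    where
      live' : Fin M → Bool
      live' x = live x ∧ not (x == e) ∧ not (x == σ e)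

  shrinkWhite : Fin M → BGraph n
  shrinkWhite e = record
    { M = M ; live = live' ; σ = skip live' (λ x → σ (swap e (τ e) x)) M
    ; τ = τ ; lf = lf }
    where
      live' : Fin M → Bool
      live' x = live x ∧ not (x == e) ∧ not (x == τ e)

data ShrinkAll {n : ℕ} : BGraph n → BGraph n → Set where
  finished : ∀ {G} → NoTwoValent G → ShrinkAll G G
  stepBlack : ∀ {G H} (e : Fin (BGraph.M G)) → TwoValentBlack G e →
              ShrinkAll (shrinkBlack G e) H → ShrinkAll G H
  stepWhite : ∀ {G H} (e : Fin (BGraph.M G)) → TwoValentWhite G e →
              ShrinkAll (shrinkWhite G e) H → ShrinkAll G H

module _ {c ℓ} (F : Field c ℓ) {n : ℕ} where
  open Field F

  -- weights after urban renewal (and shrinking, which keeps weights)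
  urbanWeights : (A : Fin n → Carrier) (k k₁ k₂ k₃ k₄ : Fin n) →
                 ¬ (A k ≈ 0#) → Fin n → Carrier
  urbanWeights A k k₁ k₂ k₃ k₄ nz ℓ' =
    if ℓ' == k then div (A k₁ * A k₃ + A k₂ * A k₄) (A k) nz else A ℓ'

  clusterWeights : (Q : Quiver n) (A : Fin n → Carrier) (k : Fin n) →
                   ¬ (A k ≈ 0#) → Fin n → Carrier
  clusterWeights Q A k nz ℓ' =
    if ℓ' == k
    then div (prodᶠ (λ j → pow (A j) (Q j k)) + prodᶠ (λ j → pow (A j) (Q k j))) (A k) nz
    else A ℓ'

-- Urban renewal at k changes the arrows of the quiver only next to k. The four
-- sides of k carried the arrows k → k₁, k₂ → k, k → k₃, k₄ → k; the eight new
-- edges carry them reversed together with one arrow k_a → k_b for every path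
-- k_a → k → k_b, which are the arrow counts of the mutated quiver before its
-- 2-cycles are cancelled. Shrinking a 2-valent vertex deletes two edges that
-- carry opposite arrows, so no net arrow count changes, and as all graphs
-- involved have loop-free quivers, net arrow counts determine the quiver.
-- For the weights: k has exactly the arrows from k₂, k₄ and to k₁, k₃, so the
-- exchange relation of urban renewal is the cluster mutation at k.

module Submission where

open import Defs
open import Data.Nat using (ℕ; zero; suc; _+_; _∸_; _*_)
import Data.Nat.Properties as ℕₚ
open import Data.Nat.Solver using (module +-*-Solver)
open +-*-Solver using (solve; _:+_; _:*_; _:=_; con)
open import Algebra.Properties.CommutativeSemigroup ℕₚ.+-commutativeSemigroup using (x∙yz≈y∙xz)
import Algebra.Properties.CommutativeSemigroup as CommutativeSemigroupProperties
open import Data.Fin using (Fin; toℕ; _↑ˡ_; _↑ʳ_; splitAt)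
import Data.Fin as Fin
open import Data.Fin.Patterns
open import Data.Fin.Properties
  using (_≟_; all?; splitAt-↑ˡ; splitAt-↑ʳ; splitAt⁻¹-↑ˡ; splitAt⁻¹-↑ʳ; ↑ˡ-injective; ↑ʳ-injective; toℕ-↑ˡ; toℕ-↑ʳ; toℕ<n)
import Data.Fin.Properties as Finₚ
open import Data.Bool using (Bool; true; false; if_then_else_; _∧_; _∨_; not; T)
open import Data.Bool.Properties using (∧-assoc; ∧-comm; ∧-zeroʳ; ∧-identityʳ; T-≡; T-∧; T-∨; T-not-≡)
open import Data.Empty using (⊥-elim)
open import Data.Product using (_×_; _,_; proj₁; proj₂)
open import Data.Sum using (_⊎_; inj₁; inj₂)
import Data.Sum as Sum
open import Data.Unit using (tt)
open import Function using (_∘_; flip; Equivalence)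
open import Relation.Nullary using (¬_; yes; no)
open import Relation.Nullary.Decidable using (toSum; from-yes; ¬?; _→-dec_; _×-dec_)
open import Relation.Binary.PropositionalEquality
import Relation.Binary.Reasoning.Setoid as SetoidReasoning

T⇒≡true : ∀ {b} → T b → b ≡ true
T⇒≡true = Equivalence.to T-≡

≡true⇒T : ∀ {b} → b ≡ true → T b
≡true⇒T = Equivalence.from T-≡

¬T⇒≡false : ∀ {b} → ¬ T b → b ≡ false
¬T⇒≡false {false} _ = refl
¬T⇒≡false {true} ¬t = ⊥-elim (¬t tt)

∧-guarded-swap : ∀ l g {p p′} → (T (l ∧ g) → p′ ≡ p) → (l ∧ g) ∧ p′ ≡ (l ∧ p) ∧ g
∧-guarded-swap false g _ = refl
∧-guarded-swap true false {p} _ = sym (∧-zeroʳ p)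
∧-guarded-swap true true {p} p′≡p = trans (p′≡p _) (sym (∧-identityʳ p))

==-refl : ∀ {m} (x : Fin m) → (x == x) ≡ true
==-refl x with x ≟ x
... | yes _ = refl
... | no x≢x = ⊥-elim (x≢x refl)

≢⇒==≡false : ∀ {m} {x y : Fin m} → x ≢ y → (x == y) ≡ false
≢⇒==≡false {x = x} {y} x≢y with x ≟ y
... | yes x≡y = ⊥-elim (x≢y x≡y)
... | no _ = refl

==≡true⇒≡ : ∀ {m} {x y : Fin m} → (x == y) ≡ true → x ≡ y
==≡true⇒≡ {x = x} {y} h with x ≟ y
... | yes x≡y = x≡y
==≡true⇒≡ () | no _

==≡false⇒≢ : ∀ {m} {x y : Fin m} → (x == y) ≡ false → x ≢ y
==≡false⇒≢ {x = x} eq refl with trans (sym eq) (==-refl x)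
... | ()

suc==suc : ∀ {m} (x y : Fin m) → (Fin.suc x == Fin.suc y) ≡ (x == y)
suc==suc x y with x ≟ y
... | yes _ = refl
... | no _ = refl

𝟙 : Bool → ℕ
𝟙 b = if b then 1 else 0

count-cong : ∀ {m} {p q : Fin m → Bool} → (∀ x → p x ≡ q x) → count p ≡ count q
count-cong {zero} _ = refl
count-cong {suc m} {p} {q} p≗q =
  cong₂ (λ b c → 𝟙 b + c) (p≗q 0F) (count-cong (λ x → p≗q (Fin.suc x)))

count-none : ∀ {m} {p : Fin m → Bool} → (∀ x → p x ≡ false) → count p ≡ 0
count-none {zero} _ = refl
count-none {suc m} {p} none rewrite none 0F = count-none (λ x → none (Fin.suc x))

count≡0⇒none : ∀ {m} (p : Fin m → Bool) → count p ≡ 0 → ∀ x → p x ≡ false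
count≡0⇒none {suc m} p c≡0 x with p 0F in p₀ | x
... | false | 0F = p₀
... | false | Fin.suc x′ = count≡0⇒none (λ y → p (Fin.suc y)) c≡0 x′
count≡0⇒none {suc m} p () x | true | _

count-↑ : ∀ {m} r (p : Fin (m + r) → Bool) →
  count p ≡ count (λ e → p (e ↑ˡ r)) + count (λ i → p (m ↑ʳ i))
count-↑ {zero} r p = refl
count-↑ {suc m} r p =
  trans (cong (𝟙 (p 0F) +_) (count-↑ {m} r (λ x → p (Fin.suc x))))
        (sym (ℕₚ.+-assoc (𝟙 (p 0F)) _ _))

count-remove : ∀ {m} (p : Fin m → Bool) (a : Fin m) →
  count p ≡ 𝟙 (p a) + count (λ x → p x ∧ not (x == a))
count-remove {suc m} p 0F rewrite ==-refl {suc m} 0F | ∧-zeroʳ (p 0F) =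
  cong (𝟙 (p 0F) +_) (count-cong (λ x → sym (∧-identityʳ (p (Fin.suc x)))))
count-remove {suc m} p (Fin.suc a) rewrite ∧-identityʳ (p 0F) = begin
  𝟙 p₀ + count p₊
    ≡⟨ cong (𝟙 p₀ +_) (count-remove p₊ a) ⟩
  𝟙 p₀ + (𝟙 (p₊ a) + count (λ x → p₊ x ∧ not (x == a)))
    ≡⟨ x∙yz≈y∙xz (𝟙 p₀) (𝟙 (p₊ a)) _ ⟩
  𝟙 (p₊ a) + (𝟙 p₀ + count (λ x → p₊ x ∧ not (x == a)))
    ≡˘⟨ cong (λ c → 𝟙 (p₊ a) + (𝟙 p₀ + c)) (count-cong (λ x → cong (λ b → p₊ x ∧ not b) (suc==suc x a))) ⟩
  𝟙 (p₊ a) + (𝟙 p₀ + count (λ x → p₊ x ∧ not (Fin.suc x == Fin.suc a)))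
    ∎
  where
  open ≡-Reasoning
  p₀ : Bool
  p₀ = p 0F
  p₊ : Fin m → Bool
  p₊ = p ∘ Fin.suc

count-remove₂ : ∀ {m} (p : Fin m → Bool) {a b : Fin m} → a ≢ b →
  count p ≡ (𝟙 (p a) + 𝟙 (p b)) + count (λ x → p x ∧ not (x == a) ∧ not (x == b))
count-remove₂ {m} p {a} {b} a≢b = begin
  count p
    ≡⟨ count-remove p a ⟩
  𝟙 (p a) + count p₋
    ≡⟨ cong (𝟙 (p a) +_) (count-remove p₋ b) ⟩
  𝟙 (p a) + (𝟙 (p b ∧ not (b == a)) + count (λ x → p₋ x ∧ not (x == b)))
    ≡⟨ cong₂ (λ c d → 𝟙 (p a) + (𝟙 (p b ∧ not c) + d))
             (≢⇒==≡false (a≢b ∘ sym)) (count-cong (λ x → ∧-assoc (p x) _ _)) ⟩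
  𝟙 (p a) + (𝟙 (p b ∧ true) + rest)
    ≡⟨ cong (λ c → 𝟙 (p a) + (𝟙 c + rest)) (∧-identityʳ (p b)) ⟩
  𝟙 (p a) + (𝟙 (p b) + rest)
    ≡˘⟨ ℕₚ.+-assoc (𝟙 (p a)) _ _ ⟩
  (𝟙 (p a) + 𝟙 (p b)) + rest
    ∎
  where
  open ≡-Reasoning
  p₋ : Fin m → Bool
  p₋ x = p x ∧ not (x == a)
  rest : ℕ
  rest = count (λ x → p x ∧ not (x == a) ∧ not (x == b))

[m∸n]*[n∸m]≡0 : ∀ m n → (m ∸ n) * (n ∸ m) ≡ 0
[m∸n]*[n∸m]≡0 zero zero = refl
[m∸n]*[n∸m]≡0 zero (suc n) = refl
[m∸n]*[n∸m]≡0 (suc m) zero = ℕₚ.*-zeroʳ (suc m)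
[m∸n]*[n∸m]≡0 (suc m) (suc n) = [m∸n]*[n∸m]≡0 m n

m*n≡0⇒m∸n≡m : ∀ m n → m * n ≡ 0 → m ∸ n ≡ m
m*n≡0⇒m∸n≡m zero n _ = ℕₚ.0∸n≡0 n
m*n≡0⇒m∸n≡m (suc m) zero _ = refl

-- Cancelling the 2-cycles of a ∸-reduced pair and then adding arrows
-- in one direction only is the same as adding first and cancelling once.
∸-reduced-+ : ∀ a b x y → x ≡ 0 ⊎ y ≡ 0 →
  ((a ∸ b) + x) ∸ ((b ∸ a) + y) ≡ (a + x) ∸ (b + y)
∸-reduced-+ a b x y (inj₁ refl)
  rewrite ℕₚ.+-identityʳ (a ∸ b) | ℕₚ.+-identityʳ a = reduce-left a b
  where
  reduce-left : ∀ a b → (a ∸ b) ∸ ((b ∸ a) + y) ≡ a ∸ (b + y)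
  reduce-left zero zero = refl
  reduce-left zero (suc b) = refl
  reduce-left (suc a) zero = refl
  reduce-left (suc a) (suc b) = reduce-left a b
∸-reduced-+ a b x y (inj₂ refl)
  rewrite ℕₚ.+-identityʳ (b ∸ a) | ℕₚ.+-identityʳ b = reduce-right a b
  where
  reduce-right : ∀ a b → ((a ∸ b) + x) ∸ (b ∸ a) ≡ (a + x) ∸ b
  reduce-right zero zero = refl
  reduce-right zero (suc b) = refl
  reduce-right (suc a) zero = refl
  reduce-right (suc a) (suc b) = reduce-right a b

removeTwoCycles-diag : ∀ {n} (c : Quiver n) i → removeTwoCycles c i i ≡ c i i
removeTwoCycles-diag c i rewrite ==-refl i = refl

removeTwoCycles-off : ∀ {n} (c : Quiver n) {i j} → i ≢ j →
  removeTwoCycles c i j ≡ c i j ∸ c j i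
removeTwoCycles-off c i≢j rewrite ≢⇒==≡false i≢j = refl

removeTwoCycles-cong : ∀ {n} (c d : Quiver n) →
  (∀ i → c i i ≡ d i i) → (∀ {i j} → i ≢ j → c i j ∸ c j i ≡ d i j ∸ d j i) →
  ∀ i j → removeTwoCycles c i j ≡ removeTwoCycles d i j
removeTwoCycles-cong c d loops net i j with i ≟ j
... | yes refl = loops i
... | no i≢j = net i≢j

-- mutateQuiver k Q is removeTwoCycles (premutate k Q) by definition
premutate : ∀ {n} → Fin n → Quiver n → Quiver n
premutate k Q i j = if (i == k) ∨ (j == k) then Q j i else Q i j + Q i k * Q k j

module _ {n} (k : Fin n) (Q : Quiver n) where

  premutate-kk : premutate k Q k k ≡ Q k k
  premutate-kk rewrite ==-refl k = refl

  premutate-from : ∀ j → premutate k Q k j ≡ Q j k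
  premutate-from j rewrite ==-refl k = refl

  premutate-into : ∀ {i} → i ≢ k → premutate k Q i k ≡ Q k i
  premutate-into i≢k rewrite ≢⇒==≡false i≢k | ==-refl k = refl

  premutate-away : ∀ {i j} → i ≢ k → j ≢ k → premutate k Q i j ≡ Q i j + Q i k * Q k j
  premutate-away i≢k j≢k rewrite ≢⇒==≡false i≢k | ≢⇒==≡false j≢k = refl

-- the arrow counts before (c) and after (c′) urban renewal at k
record MutationCounts {n} (k : Fin n) (c c′ : Quiver n) : Set where
  field
    into from : Fin n → ℕ
    away      : Quiver n
    into*from≡0 : ∀ j → into j * from j ≡ 0
    into-k    : into k ≡ 0
    from-k    : from k ≡ 0
    c-loop    : ∀ i → c i i ≡ 0
    c′-loop   : ∀ i → c′ i i ≡ 0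
    c-into    : ∀ {j} → j ≢ k → c j k ≡ into j
    c-from    : ∀ {j} → j ≢ k → c k j ≡ from j
    c-away    : ∀ {i j} → i ≢ k → j ≢ k → c i j ≡ away i j
    c′-into   : ∀ {j} → j ≢ k → c′ j k ≡ from j
    c′-from   : ∀ {j} → j ≢ k → c′ k j ≡ into j
    c′-away   : ∀ {i j} → i ≢ k → j ≢ k → c′ i j ≡ away i j + into i * from j

module _ {n} {k : Fin n} {c c′ : Quiver n} (counts : MutationCounts k c c′) where
  open MutationCounts counts

  removeTwoCycles-into : ∀ j → removeTwoCycles c j k ≡ into j
  removeTwoCycles-into j with j ≟ k
  ... | yes refl = trans (c-loop j) (sym into-k)
  ... | no j≢k = begin
    c j k ∸ c k j   ≡⟨ cong₂ _∸_ (c-into j≢k) (c-from j≢k) ⟩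
    into j ∸ from j ≡⟨ m*n≡0⇒m∸n≡m (into j) (from j) (into*from≡0 j) ⟩
    into j          ∎
    where open ≡-Reasoning

  removeTwoCycles-from : ∀ j → removeTwoCycles c k j ≡ from j
  removeTwoCycles-from j with k ≟ j
  ... | yes refl = trans (c-loop j) (sym from-k)
  ... | no k≢j = begin
    c k j ∸ c j k   ≡⟨ cong₂ _∸_ (c-from (k≢j ∘ sym)) (c-into (k≢j ∘ sym)) ⟩
    from j ∸ into j ≡⟨ m*n≡0⇒m∸n≡m (from j) (into j) (trans (ℕₚ.*-comm (from j) _) (into*from≡0 j)) ⟩
    from j          ∎
    where open ≡-Reasoning

  private
    Q : Quiver n
    Q = removeTwoCycles c

    -- i cannot be both a source and a target of arrows at k
    no-two-paths : ∀ i j → into i * from j ≡ 0 ⊎ into j * from i ≡ 0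
    no-two-paths i j with ℕₚ.m*n≡0⇒m≡0∨n≡0 (into i) (into*from≡0 i)
    ... | inj₁ into-i≡0 = inj₁ (cong (_* from j) into-i≡0)
    ... | inj₂ from-i≡0 = inj₂ (trans (cong (into j *_) from-i≡0) (ℕₚ.*-zeroʳ (into j)))

    loops : ∀ i → c′ i i ≡ premutate k Q i i
    loops i with toSum (i ≟ k)
    ... | inj₁ refl = trans (c′-loop k) (sym (trans (premutate-kk k Q) (trans (removeTwoCycles-diag c k) (c-loop k))))
    ... | inj₂ i≢k = begin
      c′ i i                                    ≡⟨ c′-loop i ⟩
      0 + 0                                     ≡˘⟨ cong₂ _+_ (trans (removeTwoCycles-diag c i) (c-loop i))
                                                              ([m∸n]*[n∸m]≡0 (c i k) (c k i)) ⟩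
      Q i i + (c i k ∸ c k i) * (c k i ∸ c i k) ≡˘⟨ cong (Q i i +_) (cong₂ _*_ (removeTwoCycles-off c i≢k)
                                                                           (removeTwoCycles-off c (i≢k ∘ sym))) ⟩
      Q i i + Q i k * Q k i                     ≡˘⟨ premutate-away k Q i≢k i≢k ⟩
      premutate k Q i i                         ∎
      where open ≡-Reasoning

    net : ∀ {i j} → i ≢ j → c′ i j ∸ c′ j i ≡ premutate k Q i j ∸ premutate k Q j i
    net {i} {j} i≢j with toSum (i ≟ k) | toSum (j ≟ k)
    ... | inj₁ refl | inj₁ refl = ⊥-elim (i≢j refl)
    ... | inj₁ refl | inj₂ j≢k = cong₂ _∸_
          (trans (c′-from j≢k) (sym (trans (premutate-from k Q j) (removeTwoCycles-into j))))
          (trans (c′-into j≢k) (sym (trans (premutate-into k Q j≢k) (removeTwoCycles-from j))))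
    ... | inj₂ i≢k | inj₁ refl = cong₂ _∸_
          (trans (c′-into i≢k) (sym (trans (premutate-into k Q i≢k) (removeTwoCycles-from i))))
          (trans (c′-from i≢k) (sym (trans (premutate-from k Q i) (removeTwoCycles-into i))))
    ... | inj₂ i≢k | inj₂ j≢k = begin
      c′ i j ∸ c′ j i
        ≡⟨ cong₂ _∸_ (c′-away i≢k j≢k) (c′-away j≢k i≢k) ⟩
      (away i j + into i * from j) ∸ (away j i + into j * from i)
        ≡˘⟨ ∸-reduced-+ (away i j) (away j i) (into i * from j) (into j * from i) (no-two-paths i j) ⟩
      ((away i j ∸ away j i) + into i * from j) ∸ ((away j i ∸ away i j) + into j * from i)
        ≡˘⟨ cong₂ _∸_ (cong₂ _+_ (Q-away i≢j i≢k j≢k) (Q-path i j))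
                      (cong₂ _+_ (Q-away (i≢j ∘ sym) j≢k i≢k) (Q-path j i)) ⟩
      (Q i j + Q i k * Q k j) ∸ (Q j i + Q j k * Q k i)
        ≡˘⟨ cong₂ _∸_ (premutate-away k Q i≢k j≢k) (premutate-away k Q j≢k i≢k) ⟩
      premutate k Q i j ∸ premutate k Q j i
        ∎
      where
      open ≡-Reasoning
      Q-away : ∀ {i j} → i ≢ j → i ≢ k → j ≢ k → Q i j ≡ away i j ∸ away j i
      Q-away i≢j i≢k j≢k = trans (removeTwoCycles-off c i≢j) (cong₂ _∸_ (c-away i≢k j≢k) (c-away j≢k i≢k))
      Q-path : ∀ i j → Q i k * Q k j ≡ into i * from j
      Q-path i j = cong₂ _*_ (removeTwoCycles-into i) (removeTwoCycles-from j)

  removeTwoCycles-mutation : ∀ i j → removeTwoCycles c′ i j ≡ mutateQuiver k Q i j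
  removeTwoCycles-mutation = removeTwoCycles-cong c′ (premutate k Q) loops net

isArrow : ∀ {n} (X : BGraph n) → Fin n → Fin n → Fin (BGraph.M X) → Bool
isArrow X i j e = live e ∧ (lf e == i) ∧ (rf X e == j)
  where open BGraph X

NetArrowsEq : ∀ {n} → BGraph n → BGraph n → Set
NetArrowsEq X Y = ∀ i j → arrows X i j ∸ arrows X j i ≡ arrows Y i j ∸ arrows Y j i

-- what urban renewal and shrinking preserve of IsTorusGraph, plus a loop-free quiver
record IsLooplessMap {n} (X : BGraph n) : Set where
  open BGraph X
  field
    σ-live   : ∀ e → T (live e) → T (live (σ e))
    τ-live   : ∀ e → T (live e) → T (live (τ e))
    σ-inj    : ∀ e e' → T (live e) → T (live e') → σ e ≡ σ e' → e ≡ e'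
    τ-inj    : ∀ e e' → T (live e) → T (live e') → τ e ≡ τ e' → e ≡ e'
    faceWalk : ∀ e → T (live e) → lf (τ (σ e)) ≡ lf e
    noLoop   : ∀ e → T (live e) → lf e ≢ rf X e

isArrow-loop≡false : ∀ {n} (X : BGraph n) → (∀ e → T (BGraph.live X e) → BGraph.lf X e ≢ rf X e) →
  ∀ i e → isArrow X i i e ≡ false
isArrow-loop≡false X noLoop i e with BGraph.live X e in live-e
... | false = refl
... | true with BGraph.lf X e ≟ i
...   | no _ = refl
...   | yes refl = ≢⇒==≡false (noLoop e (≡true⇒T live-e) ∘ sym)

arrows-loop≡0 : ∀ {n} {X : BGraph n} → IsLooplessMap X → ∀ i → arrows X i i ≡ 0
arrows-loop≡0 {X = X} map i = count-none (isArrow-loop≡false X (IsLooplessMap.noLoop map) i)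

quiver-loop≡0⇒noLoop : ∀ {n} (X : BGraph n) → (∀ i → quiver X i i ≡ 0) →
  ∀ e → T (BGraph.live X e) → BGraph.lf X e ≢ rf X e
quiver-loop≡0⇒noLoop X loops≡0 e live-e lf≡rf = true≢false (trans (sym is-loop) no-loop)
  where
  open BGraph X
  true≢false : true ≢ false
  true≢false ()
  no-loop : isArrow X (lf e) (lf e) e ≡ false
  no-loop = count≡0⇒none (isArrow X (lf e) (lf e))
              (trans (sym (removeTwoCycles-diag (arrows X) (lf e))) (loops≡0 (lf e))) e
  is-loop : isArrow X (lf e) (lf e) e ≡ true
  is-loop rewrite T⇒≡true live-e | sym lf≡rf | ==-refl (lf e) = refl

torus⇒looplessMap : ∀ {n} (X : BGraph n) {genus} → IsTorusGraph X genus →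
  (∀ i → quiver X i i ≡ 0) → IsLooplessMap X
torus⇒looplessMap X torus loops≡0 = record
  { σ-live = σ-live ; τ-live = τ-live ; σ-inj = σ-inj ; τ-inj = τ-inj
  ; faceWalk = faceWalk ; noLoop = quiver-loop≡0⇒noLoop X loops≡0 }
  where open IsTorusGraph torus

quiver-cong : ∀ {n} {X Y : BGraph n} → IsLooplessMap X → IsLooplessMap Y → NetArrowsEq X Y →
  ∀ i j → quiver X i j ≡ quiver Y i j
quiver-cong {X = X} {Y} mapX mapY net =
  removeTwoCycles-cong (arrows X) (arrows Y)
    (λ i → trans (arrows-loop≡0 mapX i) (sym (arrows-loop≡0 mapY i)))
    (λ {i} {j} _ → net i j)

-- Removing the darts e, f from a partial permutation π of the live darts L:
-- the new successor of x is the first surviving dart along ρ = π ∘ (e f).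

module Splice {m : ℕ} (L : Fin m → Bool) (π : Fin m → Fin m) (e f : Fin m) where

  L⁻ : Fin m → Bool
  L⁻ x = L x ∧ not (x == e) ∧ not (x == f)

  swap : Fin m → Fin m
  swap x = if x == e then f else if x == f then e else x

  ρ : Fin m → Fin m
  ρ x = π (swap x)

  liveOr : Fin m → Fin m → Fin m
  liveOr y d = if L⁻ y then y else d

  spliced : Fin m → Fin m
  spliced x = liveOr (ρ x) (liveOr (ρ (ρ x)) (ρ (ρ (ρ x))))

  liveOr-live : ∀ {y d} → L⁻ y ≡ true → liveOr y d ≡ y
  liveOr-live {y} {d} live = cong (if_then y else d) live

  liveOr-dead : ∀ {y d} → L⁻ y ≡ false → liveOr y d ≡ d
  liveOr-dead {y} {d} dead = cong (if_then y else d) dead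

  liveOr-extend : ∀ y₁ y₂ y₃ z → T (L⁻ (liveOr y₁ (liveOr y₂ y₃))) →
    liveOr y₁ (liveOr y₂ (liveOr y₃ z)) ≡ liveOr y₁ (liveOr y₂ y₃)
  liveOr-extend y₁ y₂ y₃ z live with L⁻ y₁ | L⁻ y₂ | L⁻ y₃ in live₃
  ... | true  | _     | _     = refl
  ... | false | true  | _     = refl
  ... | false | false | true  = refl
  ... | false | false | false = ⊥-elim (subst T live₃ live)

  L⁻-e : L⁻ e ≡ false
  L⁻-e rewrite ==-refl e = ∧-zeroʳ (L e)

  L⁻-f : L⁻ f ≡ false
  L⁻-f rewrite ==-refl f = trans (cong (L f ∧_) (∧-zeroʳ (not (f == e)))) (∧-zeroʳ (L f))

  L⁻⇒L : ∀ {x} → T (L⁻ x) → T (L x)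
  L⁻⇒L = proj₁ ∘ Equivalence.to T-∧

  L⁻⇒≢e : ∀ {x} → T (L⁻ x) → x ≢ e
  L⁻⇒≢e live refl = subst T L⁻-e live

  L⁻⇒≢f : ∀ {x} → T (L⁻ x) → x ≢ f
  L⁻⇒≢f live refl = subst T L⁻-f live

  L⁻-intro : ∀ {x} → T (L x) → x ≢ e → x ≢ f → L⁻ x ≡ true
  L⁻-intro {x} live x≢e x≢f rewrite ≢⇒==≡false x≢e | ≢⇒==≡false x≢f =
    trans (∧-identityʳ (L x)) (T⇒≡true live)

  ρ-e : ρ e ≡ π f
  ρ-e rewrite ==-refl e = refl

  module Spliced (e≢f : e ≢ f) (π-live : ∀ x → T (L x) → T (L (π x)))
                 (π-inj : ∀ x y → T (L x) → T (L y) → π x ≡ π y → x ≡ y)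
                 (live-e : T (L e)) (live-f : T (L f)) where

    ρ-f : ρ f ≡ π e
    ρ-f rewrite ≢⇒==≡false (e≢f ∘ sym) | ==-refl f = refl

    ρ-other : ∀ {x} → x ≢ e → x ≢ f → ρ x ≡ π x
    ρ-other x≢e x≢f rewrite ≢⇒==≡false x≢e | ≢⇒==≡false x≢f = refl

    -- The spliced successor r of x is π x unless π x was removed; then the
    -- search jumps over e to π f (over f to π e), and once more if π f = f (π e = e).
    data Step (x r : Fin m) : Set where
      direct    : r ≡ π x → Step x r
      over-e    : π x ≡ e → r ≡ π f → Step x r
      over-e-f  : π x ≡ e → π f ≡ f → r ≡ π e → Step x r
      over-f    : π x ≡ f → r ≡ π e → Step x r
      over-f-e  : π x ≡ f → π e ≡ e → r ≡ π f → Step x r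

    -- π x can be read off from the spliced successor of x
    unsplice : Fin m → Fin m
    unsplice r = if r == π f then (if π e == e then f else e)
                 else if r == π e then (if π f == f then e else f) else r

    module _ {x : Fin m} (live-x : T (L⁻ x)) where
      private
        πx≢πe : π x ≢ π e
        πx≢πe = L⁻⇒≢e live-x ∘ π-inj x e (L⁻⇒L live-x) live-e
        πx≢πf : π x ≢ π f
        πx≢πf = L⁻⇒≢f live-x ∘ π-inj x f (L⁻⇒L live-x) live-f
        πe≢πf : π e ≢ π f
        πe≢πf = e≢f ∘ π-inj e f live-e live-f

        L⁻-π : ∀ {y} → T (L y) → π y ≢ e → π y ≢ f → L⁻ (π y) ≡ true
        L⁻-π live-y = L⁻-intro (π-live _ live-y)

        reached : ∀ {r r′} → r ≡ r′ → L⁻ r′ ≡ true → T (L⁻ r)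
        reached refl = ≡true⇒T

      open ≡-Reasoning

      resolve-at : ∀ y → π x ≡ y →
        let r = liveOr y (liveOr (ρ y) (ρ (ρ y))) in Step x r × T (L⁻ r)
      resolve-at y πx≡y with toSum (y ≟ e) | toSum (y ≟ f)
      ... | inj₁ refl | _ with toSum (π f ≟ e) | toSum (π f ≟ f)
      ...   | inj₁ πf≡e | _ = ⊥-elim (πx≢πf (trans πx≡y (sym πf≡e)))
      ...   | inj₂ πf≢e | inj₂ πf≢f = over-e πx≡y reach , reached reach live-πf
        where
        live-πf : L⁻ (π f) ≡ true
        live-πf = L⁻-π live-f πf≢e πf≢f
        reach : liveOr e (liveOr (ρ e) (ρ (ρ e))) ≡ π f
        reach = begin
          liveOr e (liveOr (ρ e) (ρ (ρ e))) ≡⟨ liveOr-dead L⁻-e ⟩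
          liveOr (ρ e) (ρ (ρ e))            ≡⟨ liveOr-live (trans (cong L⁻ ρ-e) live-πf) ⟩
          ρ e                                ≡⟨ ρ-e ⟩
          π f                                ∎
      ...   | inj₂ πf≢e | inj₁ πf≡f = over-e-f πx≡y πf≡f reach , reached reach live-πe
        where
        live-πe : L⁻ (π e) ≡ true
        live-πe = L⁻-π live-e (πx≢πe ∘ trans πx≡y ∘ sym) (πe≢πf ∘ flip trans (sym πf≡f))
        ρe≡f : ρ e ≡ f
        ρe≡f = trans ρ-e πf≡f
        reach : liveOr e (liveOr (ρ e) (ρ (ρ e))) ≡ π e
        reach = begin
          liveOr e (liveOr (ρ e) (ρ (ρ e))) ≡⟨ liveOr-dead L⁻-e ⟩
          liveOr (ρ e) (ρ (ρ e))            ≡⟨ liveOr-dead (trans (cong L⁻ ρe≡f) L⁻-f) ⟩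
          ρ (ρ e)                            ≡⟨ cong ρ ρe≡f ⟩
          ρ f                                ≡⟨ ρ-f ⟩
          π e                                ∎
      resolve-at y πx≡y | inj₂ y≢e | inj₁ refl with toSum (π e ≟ f) | toSum (π e ≟ e)
      ...   | inj₁ πe≡f | _ = ⊥-elim (πx≢πe (trans πx≡y (sym πe≡f)))
      ...   | inj₂ πe≢f | inj₂ πe≢e = over-f πx≡y reach , reached reach live-πe
        where
        live-πe : L⁻ (π e) ≡ true
        live-πe = L⁻-π live-e πe≢e πe≢f
        reach : liveOr f (liveOr (ρ f) (ρ (ρ f))) ≡ π e
        reach = begin
          liveOr f (liveOr (ρ f) (ρ (ρ f))) ≡⟨ liveOr-dead L⁻-f ⟩
          liveOr (ρ f) (ρ (ρ f))            ≡⟨ liveOr-live (trans (cong L⁻ ρ-f) live-πe) ⟩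
          ρ f                                ≡⟨ ρ-f ⟩
          π e                                ∎
      ...   | inj₂ πe≢f | inj₁ πe≡e = over-f-e πx≡y πe≡e reach , reached reach live-πf
        where
        live-πf : L⁻ (π f) ≡ true
        live-πf = L⁻-π live-f (πe≢πf ∘ trans πe≡e ∘ sym) (πx≢πf ∘ trans πx≡y ∘ sym)
        ρf≡e : ρ f ≡ e
        ρf≡e = trans ρ-f πe≡e
        reach : liveOr f (liveOr (ρ f) (ρ (ρ f))) ≡ π f
        reach = begin
          liveOr f (liveOr (ρ f) (ρ (ρ f))) ≡⟨ liveOr-dead L⁻-f ⟩
          liveOr (ρ f) (ρ (ρ f))            ≡⟨ liveOr-dead (trans (cong L⁻ ρf≡e) L⁻-e) ⟩
          ρ (ρ f)                            ≡⟨ cong ρ ρf≡e ⟩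
          ρ e                                ≡⟨ ρ-e ⟩
          π f                                ∎
      resolve-at y πx≡y | inj₂ y≢e | inj₂ y≢f = direct (trans reach (sym πx≡y)) , reached reach live-y
        where
        live-y : L⁻ y ≡ true
        live-y = L⁻-intro (subst (T ∘ L) πx≡y (π-live x (L⁻⇒L live-x))) y≢e y≢f
        reach : liveOr y (liveOr (ρ y) (ρ (ρ y))) ≡ y
        reach = liveOr-live live-y

      resolve : Step x (spliced x) × T (L⁻ (spliced x))
      resolve = subst (λ y → let r = liveOr y (liveOr (ρ y) (ρ (ρ y))) in Step x r × T (L⁻ r))
                      (sym (ρ-other (L⁻⇒≢e live-x) (L⁻⇒≢f live-x))) (resolve-at (π x) refl)

      π≡unsplice : ∀ {r} → Step x r → π x ≡ unsplice r
      π≡unsplice (direct refl) rewrite ≢⇒==≡false πx≢πf | ≢⇒==≡false πx≢πe = refl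
      π≡unsplice (over-e πx≡e refl) rewrite ==-refl (π f) | ≢⇒==≡false (πx≢πe ∘ trans πx≡e ∘ sym) = πx≡e
      π≡unsplice (over-e-f πx≡e πf≡f refl) rewrite ≢⇒==≡false πe≢πf | ==-refl (π e) | πf≡f | ==-refl f = πx≡e
      π≡unsplice (over-f πx≡f refl)
        rewrite ≢⇒==≡false πe≢πf | ==-refl (π e) | ≢⇒==≡false (πx≢πf ∘ trans πx≡f ∘ sym) = πx≡f
      π≡unsplice (over-f-e πx≡f πe≡e refl) rewrite ==-refl (π f) | πe≡e | ==-refl e = πx≡f

    spliced-live : ∀ x → T (L⁻ x) → T (L⁻ (spliced x))
    spliced-live x live-x = proj₂ (resolve live-x)

    spliced-inj : ∀ x x′ → T (L⁻ x) → T (L⁻ x′) → spliced x ≡ spliced x′ → x ≡ x′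
    spliced-inj x x′ live-x live-x′ same = π-inj x x′ (L⁻⇒L live-x) (L⁻⇒L live-x′) (begin
      π x                   ≡⟨ π≡unsplice live-x (proj₁ (resolve live-x)) ⟩
      unsplice (spliced x)  ≡⟨ cong unsplice same ⟩
      unsplice (spliced x′) ≡˘⟨ π≡unsplice live-x′ (proj₁ (resolve live-x′)) ⟩
      π x′                  ∎)
      where open ≡-Reasoning

    -- a labelling that cannot tell e from π f, nor f from π e, sees no splice
    spliced-invariant : ∀ {a} {A : Set a} (F : Fin m → A) → F (π f) ≡ F e → F (π e) ≡ F f →
      ∀ x → T (L⁻ x) → F (spliced x) ≡ F (π x)
    spliced-invariant F πf~e πe~f x live-x with proj₁ (resolve live-x)
    ... | direct r≡πx = cong F r≡πx
    ... | over-e πx≡e r≡πf = trans (cong F r≡πf) (trans πf~e (cong F (sym πx≡e)))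
    ... | over-e-f πx≡e πf≡f r≡πe =
          trans (cong F r≡πe) (trans πe~f (trans (cong F (sym πf≡f))
                (trans πf~e (cong F (sym πx≡e)))))
    ... | over-f πx≡f r≡πe = trans (cong F r≡πe) (trans πe~f (cong F (sym πx≡f)))
    ... | over-f-e πx≡f πe≡e r≡πf =
          trans (cong F r≡πf) (trans πf~e (trans (cong F (sym πe≡e))
                (trans πe~f (cong F (sym πx≡f)))))

remove-2-cycle : ∀ {n} (X X′ : BGraph n) {e f : Fin (BGraph.M X)} → e ≢ f →
  T (BGraph.live X e) → T (BGraph.live X f) → rf X e ≡ BGraph.lf X f → rf X f ≡ BGraph.lf X e →
  (∀ i j → arrows X′ i j ≡ count (λ x → isArrow X i j x ∧ not (x == e) ∧ not (x == f))) →
  NetArrowsEq X′ X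
remove-2-cycle {n} X X′ {e} {f} e≢f live-e live-f rf-e rf-f arrows′ i j = begin
  arrows X′ i j ∸ arrows X′ j i
    ≡⟨ cong₂ _∸_ (arrows′ i j) (arrows′ j i) ⟩
  rest i j ∸ rest j i
    ≡˘⟨ ℕₚ.[m+n]∸[m+o]≡n∸o (ends j i) (rest i j) (rest j i) ⟩
  (ends j i + rest i j) ∸ (ends j i + rest j i)
    ≡˘⟨ cong (λ s → (s + rest i j) ∸ (ends j i + rest j i)) opposite ⟩
  (ends i j + rest i j) ∸ (ends j i + rest j i)
    ≡˘⟨ cong₂ _∸_ (count-remove₂ (isArrow X i j) e≢f) (count-remove₂ (isArrow X j i) e≢f) ⟩
  arrows X i j ∸ arrows X j i
    ∎
  where
  open ≡-Reasoning
  open BGraph X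
  ends : Fin n → Fin n → ℕ
  ends i j = 𝟙 (isArrow X i j e) + 𝟙 (isArrow X i j f)
  rest : Fin n → Fin n → ℕ
  rest i j = count (λ x → isArrow X i j x ∧ not (x == e) ∧ not (x == f))
  at-e : ∀ i j → isArrow X i j e ≡ (lf e == i) ∧ (lf f == j)
  at-e i j rewrite T⇒≡true live-e | rf-e = refl
  at-f : ∀ i j → isArrow X i j f ≡ (lf f == i) ∧ (lf e == j)
  at-f i j rewrite T⇒≡true live-f | rf-f = refl
  opposite : ends i j ≡ ends j i
  opposite rewrite at-e i j | at-f i j | at-e j i | at-f j i =
    trans (ℕₚ.+-comm (𝟙 ((lf e == i) ∧ (lf f == j))) _)
          (cong₂ _+_ (cong 𝟙 (∧-comm (lf f == i) (lf e == j))) (cong 𝟙 (∧-comm (lf e == i) (lf f == j))))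

-- Defs follows ρ for M steps; once M ≥ 2 the first three steps already
-- reach the spliced successor.
shrinkBlack-τ : ∀ {n m} (L : Fin (suc (suc m)) → Bool) (σ τ : Fin (suc (suc m)) → Fin (suc (suc m)))
  (lf : Fin (suc (suc m)) → Fin n) (e x : Fin (suc (suc m))) →
  let open Splice L τ e (σ e) in T (L⁻ (spliced x)) →
  BGraph.τ (shrinkBlack (record { M = suc (suc m) ; live = L ; σ = σ ; τ = τ ; lf = lf }) e) x ≡ spliced x
shrinkBlack-τ {m = zero} L σ τ lf e x _ = refl
shrinkBlack-τ {m = suc m} L σ τ lf e x live = liveOr-extend (ρ x) (ρ (ρ x)) (ρ (ρ (ρ x))) _ live
  where open Splice L τ e (σ e)

shrinkWhite-σ : ∀ {n m} (L : Fin (suc (suc m)) → Bool) (σ τ : Fin (suc (suc m)) → Fin (suc (suc m)))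
  (lf : Fin (suc (suc m)) → Fin n) (e x : Fin (suc (suc m))) →
  let open Splice L σ e (τ e) in T (L⁻ (spliced x)) →
  BGraph.σ (shrinkWhite (record { M = suc (suc m) ; live = L ; σ = σ ; τ = τ ; lf = lf }) e) x ≡ spliced x
shrinkWhite-σ {m = zero} L σ τ lf e x _ = refl
shrinkWhite-σ {m = suc m} L σ τ lf e x live = liveOr-extend (ρ x) (ρ (ρ x)) (ρ (ρ (ρ x))) _ live
  where open Splice L σ e (τ e)

shrinkBlack-preserves : ∀ {n} (X : BGraph n) (e : Fin (BGraph.M X)) →
  IsLooplessMap X → TwoValentBlack X e → IsLooplessMap (shrinkBlack X e) × NetArrowsEq (shrinkBlack X e) X
shrinkBlack-preserves record { M = zero } () _ _
shrinkBlack-preserves record { M = suc zero ; σ = σ } 0F _ (_ , σe≢e , _) with σ 0F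
... | 0F = ⊥-elim (σe≢e refl)
shrinkBlack-preserves {n} X@record { M = suc (suc m) ; live = L ; σ = σ ; τ = τ ; lf = lf } e map
  (live-e , σe≢e , σσe≡e) =
  record { σ-live = σ-live′ ; τ-live = τ-live′ ; σ-inj = σ-inj′ ; τ-inj = τ-inj′
         ; faceWalk = faceWalk′ ; noLoop = noLoop′ }
  , remove-2-cycle X (shrinkBlack X e) e≢f live-e live-f lf-τe (faceWalk e live-e)
      (λ i j → count-cong (λ x → ∧-guarded-swap (L x) _ (cong (λ y → (lf x == i) ∧ (y == j)) ∘ lf-τ′ x)))
  where
  open IsLooplessMap map
  f : Fin (suc (suc m))
  f = σ e
  e≢f : e ≢ f
  e≢f = σe≢e ∘ sym
  live-f : T (L f)
  live-f = σ-live e live-e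
  open Splice L τ e f
  open Spliced e≢f τ-live τ-inj live-e live-f
  τ′ : Fin (suc (suc m)) → Fin (suc (suc m))
  τ′ = BGraph.τ (shrinkBlack X e)
  lf-τe : lf (τ e) ≡ lf f
  lf-τe = trans (cong (lf ∘ τ) (sym σσe≡e)) (faceWalk f live-f)
  τ′≡spliced : ∀ x → T (L⁻ x) → τ′ x ≡ spliced x
  τ′≡spliced x live-x = shrinkBlack-τ L σ τ lf e x (spliced-live x live-x)
  lf-τ′ : ∀ x → T (L⁻ x) → lf (τ′ x) ≡ lf (τ x)
  lf-τ′ x live-x = trans (cong lf (τ′≡spliced x live-x))
    (spliced-invariant lf (faceWalk e live-e) lf-τe x live-x)
  σ-live′ : ∀ x → T (L⁻ x) → T (L⁻ (σ x))
  σ-live′ x live-x = ≡true⇒T (L⁻-intro (σ-live x (L⁻⇒L live-x)) σx≢e σx≢f)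
    where
    σx≢e : σ x ≢ e
    σx≢e σx≡e = L⁻⇒≢f live-x (σ-inj x f (L⁻⇒L live-x) live-f (trans σx≡e (sym σσe≡e)))
    σx≢f : σ x ≢ f
    σx≢f = L⁻⇒≢e live-x ∘ σ-inj x e (L⁻⇒L live-x) live-e
  τ-live′ : ∀ x → T (L⁻ x) → T (L⁻ (τ′ x))
  τ-live′ x live-x = subst (T ∘ L⁻) (sym (τ′≡spliced x live-x)) (spliced-live x live-x)
  σ-inj′ : ∀ x y → T (L⁻ x) → T (L⁻ y) → σ x ≡ σ y → x ≡ y
  σ-inj′ x y live-x live-y = σ-inj x y (L⁻⇒L live-x) (L⁻⇒L live-y)
  τ-inj′ : ∀ x y → T (L⁻ x) → T (L⁻ y) → τ′ x ≡ τ′ y → x ≡ y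
  τ-inj′ x y live-x live-y same = spliced-inj x y live-x live-y
    (trans (sym (τ′≡spliced x live-x)) (trans same (τ′≡spliced y live-y)))
  faceWalk′ : ∀ x → T (L⁻ x) → lf (τ′ (σ x)) ≡ lf x
  faceWalk′ x live-x = trans (lf-τ′ (σ x) (σ-live′ x live-x)) (faceWalk x (L⁻⇒L live-x))
  noLoop′ : ∀ x → T (L⁻ x) → lf x ≢ lf (τ′ x)
  noLoop′ x live-x loop = noLoop x (L⁻⇒L live-x) (trans loop (lf-τ′ x live-x))

shrinkWhite-preserves : ∀ {n} (X : BGraph n) (e : Fin (BGraph.M X)) →
  IsLooplessMap X → TwoValentWhite X e → IsLooplessMap (shrinkWhite X e) × NetArrowsEq (shrinkWhite X e) X
shrinkWhite-preserves record { M = zero } () _ _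
shrinkWhite-preserves record { M = suc zero ; τ = τ } 0F _ (_ , τe≢e , _) with τ 0F
... | 0F = ⊥-elim (τe≢e refl)
shrinkWhite-preserves {n} X@record { M = suc (suc m) ; live = L ; σ = σ ; τ = τ ; lf = lf } e map
  (live-e , τe≢e , ττe≡e) =
  record { σ-live = σ-live′ ; τ-live = τ-live′ ; σ-inj = σ-inj′ ; τ-inj = τ-inj′
         ; faceWalk = faceWalk′ ; noLoop = noLoop′ }
  , remove-2-cycle X (shrinkWhite X e) e≢g live-e live-g refl (cong lf ττe≡e)
      (λ i j → count-cong (λ x → ∧-guarded-swap (L x) (not (x == e) ∧ not (x == g))
                                   {(lf x == i) ∧ (lf (τ x) == j)} (λ _ → refl)))
  where
  open IsLooplessMap map
  g : Fin (suc (suc m))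
  g = τ e
  e≢g : e ≢ g
  e≢g = τe≢e ∘ sym
  live-g : T (L g)
  live-g = τ-live e live-e
  open Splice L σ e g
  open Spliced e≢g σ-live σ-inj live-e live-g
  σ′ : Fin (suc (suc m)) → Fin (suc (suc m))
  σ′ = BGraph.σ (shrinkWhite X e)
  σ′≡spliced : ∀ x → T (L⁻ x) → σ′ x ≡ spliced x
  σ′≡spliced x live-x = shrinkWhite-σ L σ τ lf e x (spliced-live x live-x)
  σ-live′ : ∀ x → T (L⁻ x) → T (L⁻ (σ′ x))
  σ-live′ x live-x = subst (T ∘ L⁻) (sym (σ′≡spliced x live-x)) (spliced-live x live-x)
  τ-live′ : ∀ x → T (L⁻ x) → T (L⁻ (τ x))
  τ-live′ x live-x = ≡true⇒T (L⁻-intro (τ-live x (L⁻⇒L live-x)) τx≢e τx≢g)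
    where
    τx≢e : τ x ≢ e
    τx≢e τx≡e = L⁻⇒≢f live-x (τ-inj x g (L⁻⇒L live-x) live-g (trans τx≡e (sym ττe≡e)))
    τx≢g : τ x ≢ g
    τx≢g = L⁻⇒≢e live-x ∘ τ-inj x e (L⁻⇒L live-x) live-e
  σ-inj′ : ∀ x y → T (L⁻ x) → T (L⁻ y) → σ′ x ≡ σ′ y → x ≡ y
  σ-inj′ x y live-x live-y same = spliced-inj x y live-x live-y
    (trans (sym (σ′≡spliced x live-x)) (trans same (σ′≡spliced y live-y)))
  τ-inj′ : ∀ x y → T (L⁻ x) → T (L⁻ y) → τ x ≡ τ y → x ≡ y
  τ-inj′ x y live-x live-y = τ-inj x y (L⁻⇒L live-x) (L⁻⇒L live-y)
  faceWalk′ : ∀ x → T (L⁻ x) → lf (τ (σ′ x)) ≡ lf x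
  faceWalk′ x live-x = trans (cong (lf ∘ τ) (σ′≡spliced x live-x))
    (trans (spliced-invariant (lf ∘ τ)
              (faceWalk g live-g) (trans (faceWalk e live-e) (cong lf (sym ττe≡e))) x live-x)
           (faceWalk x (L⁻⇒L live-x)))
  noLoop′ : ∀ x → T (L⁻ x) → lf x ≢ lf (τ x)
  noLoop′ x live-x = noLoop x (L⁻⇒L live-x)

shrinkAll-preserves : ∀ {n} {X H : BGraph n} → ShrinkAll X H → IsLooplessMap X →
  IsLooplessMap H × NetArrowsEq H X
shrinkAll-preserves (finished _) map = map , λ i j → refl
shrinkAll-preserves {X = X} (stepBlack e two-valent rest) map =
  let (map₁ , net₁) = shrinkBlack-preserves X e map two-valent
      (map₂ , net₂) = shrinkAll-preserves rest map₁
  in map₂ , λ i j → trans (net₂ i j) (net₁ i j)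
shrinkAll-preserves {X = X} (stepWhite e two-valent rest) map =
  let (map₁ , net₁) = shrinkWhite-preserves X e map two-valent
      (map₂ , net₂) = shrinkAll-preserves rest map₁
  in map₂ , λ i j → trans (net₂ i j) (net₁ i j)

module UrbanRenewal {n} (G : BGraph n) {genus : Fin n → ℕ} (k : Fin n) (s₁ s₂ s₃ s₄ : Fin (BGraph.M G))
  (map : IsLooplessMap G) (quad : IsQuadFace G genus k s₁ s₂ s₃ s₄)
  (k₁≢k₂ : across₁ G s₁ ≢ across₂ G s₂) (k₂≢k₃ : across₂ G s₂ ≢ across₃ G s₃)
  (k₃≢k₄ : across₃ G s₃ ≢ across₄ G s₄) (k₄≢k₁ : across₄ G s₄ ≢ across₁ G s₁) where

  open BGraph G
  open IsLooplessMap map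
  open IsQuadFace quad

  G′ : BGraph n
  G′ = urbanRenewal G k s₁ s₂ s₃ s₄
  open BGraph G′ using () renaming (live to live′; σ to σ′; τ to τ′; lf to lf′)

  k₁ k₂ k₃ k₄ : Fin n
  k₁ = across₁ G s₁
  k₂ = across₂ G s₂
  k₃ = across₃ G s₃
  k₄ = across₄ G s₄

  old : Fin M → Fin (M + 8)
  old e = e ↑ˡ 8

  new : Fin 8 → Fin (M + 8)
  new i = M ↑ʳ i

  old≢new : ∀ e i → old e ≢ new i
  old≢new e i old≡new = ℕₚ.<⇒≢ (ℕₚ.<-≤-trans (toℕ<n e) (ℕₚ.m≤m+n M (toℕ i)))
    (trans (sym (toℕ-↑ˡ e 8)) (trans (cong toℕ old≡new) (toℕ-↑ʳ M i)))

  new-inj : ∀ {i j} → new i ≡ new j → i ≡ j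
  new-inj = ↑ʳ-injective M _ _

  dart-cases : ∀ {ℓ} (P : Fin (M + 8) → Set ℓ) → (∀ e → P (old e)) → (∀ i → P (new i)) → ∀ x → P x
  dart-cases P P-old P-new x with splitAt M x in eq
  ... | inj₁ e = subst P (splitAt⁻¹-↑ˡ eq) (P-old e)
  ... | inj₂ i = subst P (splitAt⁻¹-↑ʳ eq) (P-new i)

  live-new : ∀ i → live′ (new i) ≡ true
  live-new i rewrite splitAt-↑ʳ M 8 i = refl

  isSide : Fin M → Bool
  isSide e = (e == s₁) ∨ (e == s₂) ∨ (e == s₃) ∨ (e == s₄)

  module Redirect (a b : Fin M) (ca cb : Fin 8) where

    redirect : Fin M → Fin (M + 8)
    redirect y = if y == a then new ca else if y == b then new cb else old y

    data View (y : Fin M) : Set where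
      at-a : y ≡ a → redirect y ≡ new ca → View y
      at-b : y ≡ b → redirect y ≡ new cb → View y
      kept : y ≢ a → y ≢ b → redirect y ≡ old y → View y

    module _ (a≢b : a ≢ b) where

      view : ∀ y → View y
      view y with y == a in y≟a | y == b in y≟b
      ... | true  | _     = at-a (==≡true⇒≡ y≟a) (cong (if_then new ca else _) y≟a)
      ... | false | true  = at-b (==≡true⇒≡ y≟b)
                                 (trans (cong (if_then new ca else _) y≟a) (cong (if_then new cb else _) y≟b))
      ... | false | false = kept (==≡false⇒≢ y≟a) (==≡false⇒≢ y≟b)
                                 (trans (cong (if_then new ca else _) y≟a) (cong (if_then new cb else _) y≟b))

      redirect≡new : ∀ y {c} → redirect y ≡ new c → c ≡ ca ⊎ c ≡ cb
      redirect≡new y eq with view y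
      ... | at-a _ r≡ = inj₁ (new-inj (trans (sym eq) r≡))
      ... | at-b _ r≡ = inj₂ (new-inj (trans (sym eq) r≡))
      ... | kept _ _ r≡ = ⊥-elim (old≢new y _ (trans (sym r≡) eq))

      redirect-inj : ca ≢ cb → ∀ y y′ → redirect y ≡ redirect y′ → y ≡ y′
      redirect-inj ca≢cb y y′ eq with view y | view y′
      ... | at-a y≡a _  | at-a y′≡a _ = trans y≡a (sym y′≡a)
      ... | at-b y≡b _  | at-b y′≡b _ = trans y≡b (sym y′≡b)
      ... | at-a _ r≡   | at-b _ r′≡  = ⊥-elim (ca≢cb (new-inj (trans (sym r≡) (trans eq r′≡))))
      ... | at-b _ r≡   | at-a _ r′≡  = ⊥-elim (ca≢cb (new-inj (trans (sym r′≡) (trans (sym eq) r≡))))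
      ... | kept _ _ r≡ | kept _ _ r′≡ = ↑ˡ-injective 8 y y′ (trans (sym r≡) (trans eq r′≡))
      ... | kept _ _ r≡ | at-a _ r′≡  = ⊥-elim (old≢new y ca (trans (sym r≡) (trans eq r′≡)))
      ... | kept _ _ r≡ | at-b _ r′≡  = ⊥-elim (old≢new y cb (trans (sym r≡) (trans eq r′≡)))
      ... | at-a _ r≡   | kept _ _ r′≡ = ⊥-elim (old≢new y′ ca (trans (sym r′≡) (trans (sym eq) r≡)))
      ... | at-b _ r≡   | kept _ _ r′≡ = ⊥-elim (old≢new y′ cb (trans (sym r′≡) (trans (sym eq) r≡)))

      redirect-live : ∀ y → (y ≢ a → y ≢ b → T (live′ (old y))) → T (live′ (redirect y))
      redirect-live y old-live with view y
      ... | at-a _ r≡ = subst (T ∘ live′) (sym r≡) (≡true⇒T (live-new ca))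
      ... | at-b _ r≡ = subst (T ∘ live′) (sym r≡) (≡true⇒T (live-new cb))
      ... | kept y≢a y≢b r≡ = subst (T ∘ live′) (sym r≡) (old-live y≢a y≢b)

  -- At the corner
  -- where the sides a and a′ = π a meet, both are replaced by the spoke ca,
  -- whose successor is that of a′ (likewise b, b′ = π b and cb); the new
  -- darts inside the quadrilateral rotate by the table t.
  module Rotation (π : Fin M → Fin M) (a a′ b b′ : Fin M) (ca cb : Fin 8) (t : Fin 8 → Fin 8) where
    open Redirect a b ca cb public

    rotᴺ : Fin 8 → Fin (M + 8)
    rotᴺ i = if i == ca then redirect (π a′) else if i == cb then redirect (π b′) else new (t i)

    private
      branch-a : Fin 8 → Bool → Fin (M + 8)
      branch-a i c = if c then redirect (π a′) else if i == cb then redirect (π b′) else new (t i)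

      branch-b : Fin 8 → Bool → Fin (M + 8)
      branch-b i c = if c then redirect (π b′) else new (t i)

    data RotView (i : Fin 8) : Set where
      corner-a : i ≡ ca → rotᴺ i ≡ redirect (π a′) → RotView i
      corner-b : i ≡ cb → rotᴺ i ≡ redirect (π b′) → RotView i
      inside   : i ≢ ca → i ≢ cb → rotᴺ i ≡ new (t i) → RotView i

    rotView : ∀ i → RotView i
    rotView i with i == ca in i≟ca | i == cb in i≟cb
    ... | true  | _     = corner-a (==≡true⇒≡ i≟ca) (cong (branch-a i) i≟ca)
    ... | false | true  = corner-b (==≡true⇒≡ i≟cb) (trans (cong (branch-a i) i≟ca) (cong (branch-b i) i≟cb))
    ... | false | false = inside (==≡false⇒≢ i≟ca) (==≡false⇒≢ i≟cb)
                                 (trans (cong (branch-a i) i≟ca) (cong (branch-b i) i≟cb))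

    module Rotates (π′ : Fin (M + 8) → Fin (M + 8))
             (π′-old : ∀ e → π′ (old e) ≡ redirect (π e))
             (π′-new : ∀ i → π′ (new i) ≡ rotᴺ i)
             (π-live : ∀ e → T (live e) → T (live (π e)))
             (π-inj : ∀ e e′ → T (live e) → T (live e′) → π e ≡ π e′ → e ≡ e′)
             (live-a : T (live a)) (live-b : T (live b)) (πa≡a′ : π a ≡ a′) (πb≡b′ : π b ≡ b′)
             (a≢b : a ≢ b) (a≢a′ : a ≢ a′) (a≢b′ : a ≢ b′) (b≢a′ : b ≢ a′) (b≢b′ : b ≢ b′)
             (ca≢cb : ca ≢ cb)
             (t-inj : ∀ i j → t i ≡ t j → i ≡ j)
             (t-inside : ∀ i → i ≢ ca → i ≢ cb → t i ≢ ca × t i ≢ cb)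
             (old-live⇒ : ∀ e → T (live′ (old e)) → T (live e) × e ≢ a × e ≢ b × e ≢ a′ × e ≢ b′)
             (⇒old-live : ∀ e → T (live e) → e ≢ a → e ≢ b → e ≢ a′ → e ≢ b′ → T (live′ (old e)))
             where

      private
        π-≢ : ∀ {e e′} → T (live e) → T (live e′) → e ≢ e′ → π e ≢ π e′
        π-≢ live-e live-e′ e≢e′ = e≢e′ ∘ π-inj _ _ live-e live-e′

        live-a′ : T (live a′)
        live-a′ = subst (T ∘ live) πa≡a′ (π-live a live-a)
        live-b′ : T (live b′)
        live-b′ = subst (T ∘ live) πb≡b′ (π-live b live-b)

        redirect-π-live : ∀ e → T (live e) → e ≢ a → e ≢ b → T (live′ (redirect (π e)))
        redirect-π-live e live-e e≢a e≢b = redirect-live a≢b (π e) λ πe≢a πe≢b →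
          ⇒old-live (π e) (π-live e live-e) πe≢a πe≢b
            (subst (π e ≢_) πa≡a′ (π-≢ live-e live-a e≢a)) (subst (π e ≢_) πb≡b′ (π-≢ live-e live-b e≢b))

        rotᴺ-live : ∀ i → T (live′ (rotᴺ i))
        rotᴺ-live i with rotView i
        ... | corner-a _ r≡ = subst (T ∘ live′) (sym r≡) (redirect-π-live a′ live-a′ (a≢a′ ∘ sym) (b≢a′ ∘ sym))
        ... | corner-b _ r≡ = subst (T ∘ live′) (sym r≡) (redirect-π-live b′ live-b′ (a≢b′ ∘ sym) (b≢b′ ∘ sym))
        ... | inside _ _ r≡ = subst (T ∘ live′) (sym r≡) (≡true⇒T (live-new _))

        redirect-π-inj : ∀ e e′ → T (live e) → T (live e′) → redirect (π e) ≡ redirect (π e′) → e ≡ e′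
        redirect-π-inj e e′ live-e live-e′ = π-inj e e′ live-e live-e′ ∘ redirect-inj a≢b ca≢cb (π e) (π e′)

        redirect≢inside : ∀ y {i} → i ≢ ca → i ≢ cb → redirect y ≢ new (t i)
        redirect≢inside y i≢ca i≢cb eq with redirect≡new a≢b y eq
        ... | inj₁ ti≡ca = proj₁ (t-inside _ i≢ca i≢cb) ti≡ca
        ... | inj₂ ti≡cb = proj₂ (t-inside _ i≢ca i≢cb) ti≡cb

        old≢rotᴺ : ∀ e i → T (live′ (old e)) → redirect (π e) ≢ rotᴺ i
        old≢rotᴺ e i live′-e eq with old-live⇒ e live′-e | rotView i
        ... | live-e , _ , _ , e≢a′ , _ | corner-a _ r≡ = e≢a′ (redirect-π-inj e a′ live-e live-a′ (trans eq r≡))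
        ... | live-e , _ , _ , _ , e≢b′ | corner-b _ r≡ = e≢b′ (redirect-π-inj e b′ live-e live-b′ (trans eq r≡))
        ... | _ | inside i≢ca i≢cb r≡ = redirect≢inside (π e) i≢ca i≢cb (trans eq r≡)

        corners-differ : redirect (π a′) ≢ redirect (π b′)
        corners-differ eq = a≢b (π-inj a b live-a live-b
          (trans πa≡a′ (trans (redirect-π-inj a′ b′ live-a′ live-b′ eq) (sym πb≡b′))))

        rotᴺ-inj : ∀ i j → rotᴺ i ≡ rotᴺ j → i ≡ j
        rotᴺ-inj i j eq with rotView i | rotView j
        ... | corner-a i≡ _ | corner-a j≡ _ = trans i≡ (sym j≡)
        ... | corner-b i≡ _ | corner-b j≡ _ = trans i≡ (sym j≡)
        ... | corner-a _ r≡ | corner-b _ r′≡ = ⊥-elim (corners-differ (trans (sym r≡) (trans eq r′≡)))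
        ... | corner-b _ r≡ | corner-a _ r′≡ = ⊥-elim (corners-differ (trans (sym r′≡) (trans (sym eq) r≡)))
        ... | corner-a _ r≡ | inside j≢ca j≢cb r′≡ =
              ⊥-elim (redirect≢inside (π a′) j≢ca j≢cb (trans (sym r≡) (trans eq r′≡)))
        ... | corner-b _ r≡ | inside j≢ca j≢cb r′≡ =
              ⊥-elim (redirect≢inside (π b′) j≢ca j≢cb (trans (sym r≡) (trans eq r′≡)))
        ... | inside i≢ca i≢cb r≡ | corner-a _ r′≡ =
              ⊥-elim (redirect≢inside (π a′) i≢ca i≢cb (trans (sym r′≡) (trans (sym eq) r≡)))
        ... | inside i≢ca i≢cb r≡ | corner-b _ r′≡ =
              ⊥-elim (redirect≢inside (π b′) i≢ca i≢cb (trans (sym r′≡) (trans (sym eq) r≡)))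
        ... | inside _ _ r≡ | inside _ _ r′≡ = t-inj i j (new-inj (trans (sym r≡) (trans eq r′≡)))

      π′-live : ∀ x → T (live′ x) → T (live′ (π′ x))
      π′-live = dart-cases _
        (λ e live′-e → let (live-e , e≢a , e≢b , _) = old-live⇒ e live′-e in
                       subst (T ∘ live′) (sym (π′-old e)) (redirect-π-live e live-e e≢a e≢b))
        (λ i _ → subst (T ∘ live′) (sym (π′-new i)) (rotᴺ-live i))

      π′-inj : ∀ x y → T (live′ x) → T (live′ y) → π′ x ≡ π′ y → x ≡ y
      π′-inj = dart-cases _
        (λ e → dart-cases _ (old-old e) (λ j live′-e _ → ⊥-elim ∘ old-new e j live′-e))
        (λ i → dart-cases _ (λ e′ _ live′-e′ → ⊥-elim ∘ old-new e′ i live′-e′ ∘ sym)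
                            (λ j _ _ → cong new ∘ new-new i j))
        where
        old-old : ∀ e e′ → T (live′ (old e)) → T (live′ (old e′)) → π′ (old e) ≡ π′ (old e′) → old e ≡ old e′
        old-old e e′ live′-e live′-e′ eq = cong old (redirect-π-inj e e′
          (proj₁ (old-live⇒ e live′-e)) (proj₁ (old-live⇒ e′ live′-e′))
          (trans (sym (π′-old e)) (trans eq (π′-old e′))))
        old-new : ∀ e i → T (live′ (old e)) → π′ (old e) ≢ π′ (new i)
        old-new e i live′-e eq = old≢rotᴺ e i live′-e (trans (sym (π′-old e)) (trans eq (π′-new i)))
        new-new : ∀ i j → π′ (new i) ≡ π′ (new j) → i ≡ j
        new-new i j eq = rotᴺ-inj i j (trans (sym (π′-new i)) (trans eq (π′-new j)))

  -- Rotations at the new vertices, with p₁ … p₄ = 0F … 3F and q₁ … q₄ = 4F … 7F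
  -- as in Defs: u₂′ = (p₂ q₂ q₁), u₄′ = (p₄ q₄ q₃), u₁′ = (p₁ q₁ q₄), u₃′ = (p₃ q₃ q₂).
  -- The values at the spokes through old corners are never used.
  tσ tτ : Fin 8 → Fin 8
  tσ 0F = 0F
  tσ 1F = 5F
  tσ 2F = 2F
  tσ 3F = 7F
  tσ 4F = 1F
  tσ 5F = 4F
  tσ 6F = 3F
  tσ 7F = 6F
  tτ 0F = 4F
  tτ 1F = 1F
  tτ 2F = 6F
  tτ 3F = 3F
  tτ 4F = 7F
  tτ 5F = 2F
  tτ 6F = 5F
  tτ 7F = 0F

  module Black = Rotation σ s₁ s₄ s₃ s₂ 0F 2F tσ
  module White = Rotation τ s₂ s₁ s₄ s₃ 1F 3F tτ

  redirB redirW : Fin M → Fin (M + 8)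
  redirB = Black.redirect
  redirW = White.redirect

  live-old : ∀ e → live′ (old e) ≡ live e ∧ not (isSide e)
  live-old e rewrite splitAt-↑ˡ M e 8 = refl

  σ-old : ∀ e → σ′ (old e) ≡ redirB (σ e)
  σ-old e rewrite splitAt-↑ˡ M e 8 = refl

  τ-old : ∀ e → τ′ (old e) ≡ redirW (τ e)
  τ-old e rewrite splitAt-↑ˡ M e 8 = refl

  lf-old : ∀ e → lf′ (old e) ≡ lf e
  lf-old e rewrite splitAt-↑ˡ M e 8 = refl

  σᴺ τᴺ : Fin 8 → Fin (M + 8)
  σᴺ = Black.rotᴺ
  τᴺ = White.rotᴺ

  lfᴺ rfᴺ : Fin 8 → Fin n
  lfᴺ 0F = k₄
  lfᴺ 1F = k₂
  lfᴺ 2F = k₂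
  lfᴺ 3F = k₄
  lfᴺ 4F = k₁
  lfᴺ 5F = k
  lfᴺ 6F = k₃
  lfᴺ 7F = k
  rfᴺ 0F = k₁
  rfᴺ 1F = k₁
  rfᴺ 2F = k₃
  rfᴺ 3F = k₃
  rfᴺ 4F = k
  rfᴺ 5F = k₂
  rfᴺ 6F = k
  rfᴺ 7F = k₄

  new-dart : ∀ i → σ′ (new i) ≡ σᴺ i × τ′ (new i) ≡ τᴺ i × lf′ (new i) ≡ lfᴺ i
  new-dart i rewrite splitAt-↑ʳ M 8 i with i
  ... | 0F = refl , refl , refl
  ... | 1F = refl , refl , refl
  ... | 2F = refl , refl , refl
  ... | 3F = refl , refl , refl
  ... | 4F = refl , refl , refl
  ... | 5F = refl , refl , refl
  ... | 6F = refl , refl , refl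
  ... | 7F = refl , refl , refl

  σ-new : ∀ i → σ′ (new i) ≡ σᴺ i
  σ-new = proj₁ ∘ new-dart

  τ-new : ∀ i → τ′ (new i) ≡ τᴺ i
  τ-new = proj₁ ∘ proj₂ ∘ new-dart

  lf-new : ∀ i → lf′ (new i) ≡ lfᴺ i
  lf-new = proj₂ ∘ proj₂ ∘ new-dart

  open Black using (at-a; at-b; kept)
  open White using (at-a; at-b; kept)

  lf-redirW : ∀ y → lf′ (redirW y) ≡ lf y
  lf-redirW y with White.view s₂≢s₄ y
  ... | at-a refl r≡ = trans (cong lf′ r≡) (lf-new 1F)
  ... | at-b refl r≡ = trans (cong lf′ r≡) (lf-new 3F)
  ... | kept _ _ r≡  = trans (cong lf′ r≡) (lf-old y)

  rf-new : ∀ i → lf′ (τ′ (new i)) ≡ rfᴺ i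
  rf-new i = trans (cong lf′ (τ-new i)) (τᴺ-face i)
    where
    τᴺ-face : ∀ i → lf′ (τᴺ i) ≡ rfᴺ i
    τᴺ-face 0F = lf-new 4F
    τᴺ-face 1F = lf-redirW (τ s₁)
    τᴺ-face 2F = lf-new 6F
    τᴺ-face 3F = lf-redirW (τ s₃)
    τᴺ-face 4F = lf-new 7F
    τᴺ-face 5F = lf-new 2F
    τᴺ-face 6F = lf-new 5F
    τᴺ-face 7F = lf-new 0F

  rf-old : ∀ e → lf′ (τ′ (old e)) ≡ lf (τ e)
  rf-old e = trans (cong lf′ (τ-old e)) (lf-redirW (τ e))

  rf-redirB : ∀ y → lf′ (τ′ (redirB y)) ≡ lf (τ y)
  rf-redirB y with Black.view s₁≢s₃ y
  ... | at-a refl r≡ = trans (cong (lf′ ∘ τ′) r≡) (rf-new 0F)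
  ... | at-b refl r≡ = trans (cong (lf′ ∘ τ′) r≡) (rf-new 2F)
  ... | kept _ _ r≡  = trans (cong (lf′ ∘ τ′) r≡) (rf-old y)

  record Kept (e : Fin M) : Set where
    field
      live-e : T (live e)
      ≢s₁ : e ≢ s₁
      ≢s₂ : e ≢ s₂
      ≢s₃ : e ≢ s₃
      ≢s₄ : e ≢ s₄

  live′⇒kept : ∀ e → T (live′ (old e)) → Kept e
  live′⇒kept e live′-e = record
    { live-e = proj₁ live×notSide
    ; ≢s₁ = notSide ∘ side⇒T ∘ inj₁
    ; ≢s₂ = notSide ∘ side⇒T ∘ inj₂ ∘ inj₁
    ; ≢s₃ = notSide ∘ side⇒T ∘ inj₂ ∘ inj₂ ∘ inj₁
    ; ≢s₄ = notSide ∘ side⇒T ∘ inj₂ ∘ inj₂ ∘ inj₂ }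
    where
    live×notSide : T (live e) × T (not (isSide e))
    live×notSide = Equivalence.to T-∧ (subst T (live-old e) live′-e)
    notSide : ¬ T (isSide e)
    notSide side = subst T (Equivalence.to T-not-≡ (proj₂ live×notSide)) side
    ≡⇒T : ∀ {s} → e ≡ s → T (e == s)
    ≡⇒T refl = ≡true⇒T (==-refl e)
    side⇒T : e ≡ s₁ ⊎ e ≡ s₂ ⊎ e ≡ s₃ ⊎ e ≡ s₄ → T (isSide e)
    side⇒T = Equivalence.from T-∨ ∘ Sum.map ≡⇒T
               (Equivalence.from T-∨ ∘ Sum.map ≡⇒T (Equivalence.from T-∨ ∘ Sum.map ≡⇒T ≡⇒T))

  kept⇒live′ : ∀ e → T (live e) → e ≢ s₁ → e ≢ s₂ → e ≢ s₃ → e ≢ s₄ → T (live′ (old e))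
  kept⇒live′ e live-e ≢s₁ ≢s₂ ≢s₃ ≢s₄
    rewrite live-old e | ≢⇒==≡false ≢s₁ | ≢⇒==≡false ≢s₂ | ≢⇒==≡false ≢s₃ | ≢⇒==≡false ≢s₄
          | T⇒≡true live-e = tt

  tσ-inj : ∀ i j → tσ i ≡ tσ j → i ≡ j
  tσ-inj = from-yes (all? λ i → all? λ j → tσ i Finₚ.≟ tσ j →-dec i Finₚ.≟ j)

  tτ-inj : ∀ i j → tτ i ≡ tτ j → i ≡ j
  tτ-inj = from-yes (all? λ i → all? λ j → tτ i Finₚ.≟ tτ j →-dec i Finₚ.≟ j)

  tσ-inside : ∀ i → i ≢ 0F → i ≢ 2F → tσ i ≢ 0F × tσ i ≢ 2F
  tσ-inside = from-yes (all? λ i → ¬? (i Finₚ.≟ 0F) →-dec ¬? (i Finₚ.≟ 2F) →-dec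
                                   ¬? (tσ i Finₚ.≟ 0F) ×-dec ¬? (tσ i Finₚ.≟ 2F))

  tτ-inside : ∀ i → i ≢ 1F → i ≢ 3F → tτ i ≢ 1F × tτ i ≢ 3F
  tτ-inside = from-yes (all? λ i → ¬? (i Finₚ.≟ 1F) →-dec ¬? (i Finₚ.≟ 3F) →-dec
                                   ¬? (tτ i Finₚ.≟ 1F) ×-dec ¬? (tτ i Finₚ.≟ 3F))

  black-kept : ∀ e → T (live′ (old e)) → T (live e) × e ≢ s₁ × e ≢ s₃ × e ≢ s₄ × e ≢ s₂
  black-kept e live′-e = live-e , ≢s₁ , ≢s₃ , ≢s₄ , ≢s₂
    where open Kept (live′⇒kept e live′-e)

  black-unkept : ∀ e → T (live e) → e ≢ s₁ → e ≢ s₃ → e ≢ s₄ → e ≢ s₂ → T (live′ (old e))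
  black-unkept e live-e ≢s₁ ≢s₃ ≢s₄ ≢s₂ = kept⇒live′ e live-e ≢s₁ ≢s₂ ≢s₃ ≢s₄

  white-kept : ∀ e → T (live′ (old e)) → T (live e) × e ≢ s₂ × e ≢ s₄ × e ≢ s₁ × e ≢ s₃
  white-kept e live′-e = live-e , ≢s₂ , ≢s₄ , ≢s₁ , ≢s₃
    where open Kept (live′⇒kept e live′-e)

  white-unkept : ∀ e → T (live e) → e ≢ s₂ → e ≢ s₄ → e ≢ s₁ → e ≢ s₃ → T (live′ (old e))
  white-unkept e live-e ≢s₂ ≢s₄ ≢s₁ ≢s₃ = kept⇒live′ e live-e ≢s₁ ≢s₂ ≢s₃ ≢s₄

  module BlackRotation = Black.Rotates σ′ σ-old σ-new σ-live σ-inj live₁ live₃ at-u₁ at-u₃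
    s₁≢s₃ s₁≢s₄ s₁≢s₂ s₃≢s₄ (s₂≢s₃ ∘ sym) (λ ()) tσ-inj tσ-inside black-kept black-unkept

  module WhiteRotation = White.Rotates τ′ τ-old τ-new τ-live τ-inj live₂ live₄ at-u₂ at-u₄
    s₂≢s₄ (s₁≢s₂ ∘ sym) s₂≢s₃ (s₁≢s₄ ∘ sym) (s₃≢s₄ ∘ sym) (λ ()) tτ-inj tτ-inside white-kept white-unkept

  rf-s₂ : lf (τ s₂) ≡ k
  rf-s₂ = trans (cong lf at-u₂) left₁

  rf-s₄ : lf (τ s₄) ≡ k
  rf-s₄ = trans (cong lf at-u₄) left₃

  k≢k₁ : k ≢ k₁
  k≢k₁ = noLoop s₁ live₁ ∘ trans left₁

  k≢k₂ : k ≢ k₂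
  k≢k₂ k≡k₂ = noLoop s₂ live₂ (trans (sym k≡k₂) (sym rf-s₂))

  k≢k₃ : k ≢ k₃
  k≢k₃ = noLoop s₃ live₃ ∘ trans left₃

  k≢k₄ : k ≢ k₄
  k≢k₄ k≡k₄ = noLoop s₄ live₄ (trans (sym k≡k₄) (sym rf-s₄))

  lfᴺ≢rfᴺ : ∀ i → lfᴺ i ≢ rfᴺ i
  lfᴺ≢rfᴺ 0F = k₄≢k₁
  lfᴺ≢rfᴺ 1F = k₁≢k₂ ∘ sym
  lfᴺ≢rfᴺ 2F = k₂≢k₃
  lfᴺ≢rfᴺ 3F = k₃≢k₄ ∘ sym
  lfᴺ≢rfᴺ 4F = k≢k₁ ∘ sym
  lfᴺ≢rfᴺ 5F = k≢k₂
  lfᴺ≢rfᴺ 6F = k≢k₃ ∘ sym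
  lfᴺ≢rfᴺ 7F = k≢k₄

  σᴺ-face : ∀ i → lf′ (τ′ (σᴺ i)) ≡ lfᴺ i
  σᴺ-face 0F = trans (rf-redirB (σ s₄)) (faceWalk s₄ live₄)
  σᴺ-face 1F = rf-new 5F
  σᴺ-face 2F = trans (rf-redirB (σ s₂)) (faceWalk s₂ live₂)
  σᴺ-face 3F = rf-new 7F
  σᴺ-face 4F = rf-new 1F
  σᴺ-face 5F = rf-new 4F
  σᴺ-face 6F = rf-new 3F
  σᴺ-face 7F = rf-new 6F

  map′ : IsLooplessMap G′
  map′ = record
    { σ-live = BlackRotation.π′-live ; τ-live = WhiteRotation.π′-live
    ; σ-inj = BlackRotation.π′-inj ; τ-inj = WhiteRotation.π′-inj
    ; faceWalk = dart-cases _ faceWalk-old faceWalk-new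
    ; noLoop = dart-cases _ noLoop-old noLoop-new }
    where
    faceWalk-old : ∀ e → T (live′ (old e)) → lf′ (τ′ (σ′ (old e))) ≡ lf′ (old e)
    faceWalk-old e live′-e = begin
      lf′ (τ′ (σ′ (old e)))   ≡⟨ cong (lf′ ∘ τ′) (σ-old e) ⟩
      lf′ (τ′ (redirB (σ e))) ≡⟨ rf-redirB (σ e) ⟩
      lf (τ (σ e))            ≡⟨ faceWalk e (Kept.live-e (live′⇒kept e live′-e)) ⟩
      lf e                    ≡˘⟨ lf-old e ⟩
      lf′ (old e)             ∎
      where open ≡-Reasoning
    faceWalk-new : ∀ i → T (live′ (new i)) → lf′ (τ′ (σ′ (new i))) ≡ lf′ (new i)
    faceWalk-new i _ = trans (cong (lf′ ∘ τ′) (σ-new i)) (trans (σᴺ-face i) (sym (lf-new i)))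
    noLoop-old : ∀ e → T (live′ (old e)) → lf′ (old e) ≢ lf′ (τ′ (old e))
    noLoop-old e live′-e loop =
      noLoop e (Kept.live-e (live′⇒kept e live′-e)) (trans (sym (lf-old e)) (trans loop (rf-old e)))
    noLoop-new : ∀ i → T (live′ (new i)) → lf′ (new i) ≢ lf′ (τ′ (new i))
    noLoop-new i _ loop = lfᴺ≢rfᴺ i (trans (sym (lf-new i)) (trans loop (rf-new i)))

  arrow : Fin n → Fin n → Quiver n
  arrow a b i j = 𝟙 ((a == i) ∧ (b == j))

  sideArrows keptArrows newArrows : Quiver n
  sideArrows i j = (arrow k k₁ i j + arrow k₂ k i j) + (arrow k k₃ i j + arrow k₄ k i j)
  keptArrows i j = count (λ e → isArrow G i j e ∧ not (isSide e))
  newArrows i j = count (λ c → (lfᴺ c == i) ∧ (rfᴺ c == j))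

  private
    ∧-not-∨ : ∀ p a b c d → (p ∧ not a ∧ not b) ∧ not c ∧ not d ≡ p ∧ not (a ∨ b ∨ c ∨ d)
    ∧-not-∨ false _ _ _ _ = refl
    ∧-not-∨ true true _ _ _ = refl
    ∧-not-∨ true false true _ _ = refl
    ∧-not-∨ true false false true _ = refl
    ∧-not-∨ true false false false _ = refl

  arrows-G : ∀ i j → arrows G i j ≡ sideArrows i j + keptArrows i j
  arrows-G i j = begin
    count A
      ≡⟨ count-remove₂ A s₁≢s₂ ⟩
    (𝟙 (A s₁) + 𝟙 (A s₂)) + count A₁₂
      ≡⟨ cong ((𝟙 (A s₁) + 𝟙 (A s₂)) +_) (count-remove₂ A₁₂ s₃≢s₄) ⟩
    (𝟙 (A s₁) + 𝟙 (A s₂)) + ((𝟙 (A₁₂ s₃) + 𝟙 (A₁₂ s₄)) + count (λ x → A₁₂ x ∧ not (x == s₃) ∧ not (x == s₄)))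
      ≡⟨ cong (λ r → (𝟙 (A s₁) + 𝟙 (A s₂)) + ((𝟙 (A₁₂ s₃) + 𝟙 (A₁₂ s₄)) + r))
              (count-cong (λ x → ∧-not-∨ (A x) (x == s₁) (x == s₂) (x == s₃) (x == s₄))) ⟩
    (𝟙 (A s₁) + 𝟙 (A s₂)) + ((𝟙 (A₁₂ s₃) + 𝟙 (A₁₂ s₄)) + keptArrows i j)
      ≡⟨ cong₂ (λ a b → (𝟙 (A s₁) + 𝟙 (A s₂)) + ((𝟙 a + 𝟙 b) + keptArrows i j))
               (A₁₂≡A (s₁≢s₃ ∘ sym) (s₂≢s₃ ∘ sym)) (A₁₂≡A (s₁≢s₄ ∘ sym) (s₂≢s₄ ∘ sym)) ⟩
    (𝟙 (A s₁) + 𝟙 (A s₂)) + ((𝟙 (A s₃) + 𝟙 (A s₄)) + keptArrows i j)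
      ≡⟨ sym (ℕₚ.+-assoc (𝟙 (A s₁) + 𝟙 (A s₂)) _ _) ⟩
    ((𝟙 (A s₁) + 𝟙 (A s₂)) + (𝟙 (A s₃) + 𝟙 (A s₄))) + keptArrows i j
      ≡⟨ cong (_+ keptArrows i j) (cong₂ _+_ (cong₂ _+_ at-s₁ at-s₂) (cong₂ _+_ at-s₃ at-s₄)) ⟩
    sideArrows i j + keptArrows i j
      ∎
    where
    open ≡-Reasoning
    A A₁₂ : Fin M → Bool
    A = isArrow G i j
    A₁₂ x = A x ∧ not (x == s₁) ∧ not (x == s₂)
    A₁₂≡A : ∀ {x} → x ≢ s₁ → x ≢ s₂ → A₁₂ x ≡ A x
    A₁₂≡A x≢s₁ x≢s₂ rewrite ≢⇒==≡false x≢s₁ | ≢⇒==≡false x≢s₂ = ∧-identityʳ _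
    at-s₁ : 𝟙 (A s₁) ≡ arrow k k₁ i j
    at-s₁ rewrite T⇒≡true live₁ | left₁ = refl
    at-s₂ : 𝟙 (A s₂) ≡ arrow k₂ k i j
    at-s₂ rewrite T⇒≡true live₂ | rf-s₂ = refl
    at-s₃ : 𝟙 (A s₃) ≡ arrow k k₃ i j
    at-s₃ rewrite T⇒≡true live₃ | left₃ = refl
    at-s₄ : 𝟙 (A s₄) ≡ arrow k₄ k i j
    at-s₄ rewrite T⇒≡true live₄ | rf-s₄ = refl

  arrows-G′ : ∀ i j → arrows G′ i j ≡ keptArrows i j + newArrows i j
  arrows-G′ i j = trans (count-↑ 8 (isArrow G′ i j)) (cong₂ _+_ (count-cong at-old) (count-cong at-new))
    where
    at-old : ∀ e → isArrow G′ i j (old e) ≡ isArrow G i j e ∧ not (isSide e)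
    at-old e rewrite live-old e | lf-old e | rf-old e = ∧-guarded-swap (live e) (not (isSide e)) (λ _ → refl)
    at-new : ∀ c → isArrow G′ i j (new c) ≡ (lfᴺ c == i) ∧ (rfᴺ c == j)
    at-new c rewrite live-new c | lf-new c | rf-new c = refl

  kept-avoids-k : ∀ {e} → Kept e → lf e ≢ k × lf (τ e) ≢ k
  kept-avoids-k {e} kept-e = lf≢k , rf≢k
    where
    open Kept kept-e
    lf≢k : lf e ≢ k
    lf≢k lf≡k with onlySides e live-e lf≡k
    ... | inj₁ e≡s₁ = ≢s₁ e≡s₁
    ... | inj₂ e≡s₃ = ≢s₃ e≡s₃
    rf≢k : lf (τ e) ≢ k
    rf≢k rf≡k with onlySides (τ e) (τ-live e live-e) rf≡k
    ... | inj₁ τe≡s₁ = ≢s₂ (τ-inj e s₂ live-e live₂ (trans τe≡s₁ (sym at-u₂)))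
    ... | inj₂ τe≡s₃ = ≢s₄ (τ-inj e s₄ live-e live₄ (trans τe≡s₃ (sym at-u₄)))

  private
    kept-arrow : ∀ {i j e} → T (isArrow G i j e ∧ not (isSide e)) → Kept e × lf e ≡ i × lf (τ e) ≡ j
    kept-arrow {i} {j} {e} t =
      let arrow-e , notSide = Equivalence.to (T-∧ {isArrow G i j e}) t
          live-e , lf×rf = Equivalence.to (T-∧ {live e}) arrow-e
          lf≟i , rf≟j = Equivalence.to (T-∧ {lf e == i}) lf×rf
      in live′⇒kept e (subst T (sym (live-old e)) (Equivalence.from (T-∧ {live e}) (live-e , notSide)))
       , ==≡true⇒≡ (T⇒≡true lf≟i) , ==≡true⇒≡ (T⇒≡true rf≟j)

  kept-from-k : ∀ j → keptArrows k j ≡ 0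
  kept-from-k j = count-none λ e → ¬T⇒≡false λ t →
    let kept-e , lf≡k , _ = kept-arrow {k} {j} {e} t in proj₁ (kept-avoids-k kept-e) lf≡k

  kept-into-k : ∀ i → keptArrows i k ≡ 0
  kept-into-k i = count-none λ e → ¬T⇒≡false λ t →
    let kept-e , _ , rf≡k = kept-arrow {i} {k} {e} t in proj₂ (kept-avoids-k kept-e) rf≡k

  into from : Fin n → ℕ
  into j = 𝟙 (k₂ == j) + 𝟙 (k₄ == j)
  from j = 𝟙 (k₁ == j) + 𝟙 (k₃ == j)

  private
    k₁≢k : k₁ ≢ k
    k₁≢k = k≢k₁ ∘ sym
    k₂≢k : k₂ ≢ k
    k₂≢k = k≢k₂ ∘ sym
    k₃≢k : k₃ ≢ k
    k₃≢k = k≢k₃ ∘ sym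
    k₄≢k : k₄ ≢ k
    k₄≢k = k≢k₄ ∘ sym

    -- the four arrows k₄→k₁, k₂→k₁, k₂→k₃, k₄→k₃ of the new quadrilateral
    square-arrows : ∀ a b c d →
      𝟙 (b ∧ c) + (𝟙 (a ∧ c) + (𝟙 (a ∧ d) + (𝟙 (b ∧ d) + 0))) ≡ (𝟙 a + 𝟙 b) * (𝟙 c + 𝟙 d)
    square-arrows false false c d = refl
    square-arrows true false c d = sym (ℕₚ.+-assoc (𝟙 c) (𝟙 d) 0)
    square-arrows false true c d = sym (ℕₚ.+-assoc (𝟙 c) (𝟙 d) 0)
    square-arrows true true c d =
      solve 2 (λ x y → x :+ (x :+ (y :+ (y :+ con 0))) := con 2 :* (x :+ y)) refl (𝟙 c) (𝟙 d)

  into*from≡0 : ∀ j → into j * from j ≡ 0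
  into*from≡0 j with toSum (j ≟ k₂) | toSum (j ≟ k₄)
  ... | inj₁ refl | _ rewrite ≢⇒==≡false k₁≢k₂ | ≢⇒==≡false (k₂≢k₃ ∘ sym) = ℕₚ.*-zeroʳ (into j)
  ... | inj₂ _ | inj₁ refl rewrite ≢⇒==≡false (k₄≢k₁ ∘ sym) | ≢⇒==≡false k₃≢k₄ = ℕₚ.*-zeroʳ (into j)
  ... | inj₂ j≢k₂ | inj₂ j≢k₄ rewrite ≢⇒==≡false (j≢k₂ ∘ sym) | ≢⇒==≡false (j≢k₄ ∘ sym) = refl

  counts : MutationCounts k (arrows G) (arrows G′)
  counts = record
    { into = into ; from = from ; away = keptArrows ; into*from≡0 = into*from≡0
    ; into-k = into-k ; from-k = from-k
    ; c-loop = arrows-loop≡0 map ; c′-loop = arrows-loop≡0 map′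
    ; c-into = c-into ; c-from = c-from ; c-away = c-away
    ; c′-into = c′-into ; c′-from = c′-from ; c′-away = c′-away }
    where
    into-k : into k ≡ 0
    into-k rewrite ≢⇒==≡false k₂≢k | ≢⇒==≡false k₄≢k = refl
    from-k : from k ≡ 0
    from-k rewrite ≢⇒==≡false k₁≢k | ≢⇒==≡false k₃≢k = refl

    c-into : ∀ {j} → j ≢ k → arrows G j k ≡ into j
    c-into {j} j≢k rewrite arrows-G j k | kept-into-k j | ≢⇒==≡false (j≢k ∘ sym) | ==-refl k
      | ∧-identityʳ (k₂ == j) | ∧-identityʳ (k₄ == j) = ℕₚ.+-identityʳ (into j)
    c-from : ∀ {j} → j ≢ k → arrows G k j ≡ from j
    c-from {j} j≢k rewrite arrows-G k j | kept-from-k j | ==-refl k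
      | ≢⇒==≡false k₂≢k | ≢⇒==≡false k₄≢k | ℕₚ.+-identityʳ (𝟙 (k₁ == j)) | ℕₚ.+-identityʳ (𝟙 (k₃ == j)) =
      ℕₚ.+-identityʳ (from j)
    c-away : ∀ {i j} → i ≢ k → j ≢ k → arrows G i j ≡ keptArrows i j
    c-away {i} {j} i≢k j≢k rewrite arrows-G i j | ≢⇒==≡false (i≢k ∘ sym) | ≢⇒==≡false (j≢k ∘ sym)
      | ∧-zeroʳ (k₂ == i) | ∧-zeroʳ (k₄ == i) = refl

    c′-into : ∀ {j} → j ≢ k → arrows G′ j k ≡ from j
    c′-into {j} j≢k rewrite arrows-G′ j k | kept-into-k j | ≢⇒==≡false k₁≢k | ≢⇒==≡false k₃≢k
      | ==-refl k | ≢⇒==≡false (j≢k ∘ sym) | ∧-zeroʳ (k₄ == j) | ∧-zeroʳ (k₂ == j)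
      | ∧-identityʳ (k₁ == j) | ∧-identityʳ (k₃ == j) = cong (𝟙 (k₁ == j) +_) (ℕₚ.+-identityʳ (𝟙 (k₃ == j)))
    c′-from : ∀ {j} → j ≢ k → arrows G′ k j ≡ into j
    c′-from {j} j≢k rewrite arrows-G′ k j | kept-from-k j | ==-refl k
      | ≢⇒==≡false k₁≢k | ≢⇒==≡false k₂≢k | ≢⇒==≡false k₃≢k | ≢⇒==≡false k₄≢k =
      cong (𝟙 (k₂ == j) +_) (ℕₚ.+-identityʳ (𝟙 (k₄ == j)))
    c′-away : ∀ {i j} → i ≢ k → j ≢ k → arrows G′ i j ≡ keptArrows i j + into i * from j
    c′-away {i} {j} i≢k j≢k rewrite arrows-G′ i j | ≢⇒==≡false (i≢k ∘ sym) | ≢⇒==≡false (j≢k ∘ sym)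
      | ∧-zeroʳ (k₁ == i) | ∧-zeroʳ (k₃ == i) =
      cong (keptArrows i j +_) (square-arrows (k₂ == i) (k₄ == i) (k₁ == j) (k₃ == j))

module FieldProducts {c ℓ} (F : Field c ℓ) where
  open Field F using (Carrier; _≈_; 1#; pow; prodᶠ; *-cong; *-congˡ; *-assoc; *-identityˡ; *-identityʳ; *-commutativeSemigroup)
    renaming (_*_ to _⊗_; refl to ≈-refl; sym to ≈-sym; trans to ≈-trans; reflexive to ≈-reflexive; setoid to ≈-setoid)
  open SetoidReasoning ≈-setoid
  open CommutativeSemigroupProperties *-commutativeSemigroup using (interchange)

  pow-+ : ∀ x m p → pow x (m + p) ≈ pow x m ⊗ pow x p
  pow-+ x zero p = ≈-sym (*-identityˡ _)
  pow-+ x (suc m) p = ≈-trans (*-congˡ (pow-+ x m p)) (≈-sym (*-assoc _ _ _))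

  prodᶠ-cong : ∀ {m} {f g : Fin m → Carrier} → (∀ j → f j ≈ g j) → prodᶠ f ≈ prodᶠ g
  prodᶠ-cong {zero} _ = ≈-refl
  prodᶠ-cong {suc m} f≈g = *-cong (f≈g 0F) (prodᶠ-cong (f≈g ∘ Fin.suc))

  prodᶠ-1 : ∀ {m} → prodᶠ {m} (λ _ → 1#) ≈ 1#
  prodᶠ-1 {zero} = ≈-refl
  prodᶠ-1 {suc m} = ≈-trans (*-identityˡ _) (prodᶠ-1 {m})

  prodᶠ-⊗ : ∀ {m} (f g : Fin m → Carrier) → prodᶠ (λ j → f j ⊗ g j) ≈ prodᶠ f ⊗ prodᶠ g
  prodᶠ-⊗ {zero} f g = ≈-sym (*-identityˡ _)
  prodᶠ-⊗ {suc m} f g = ≈-trans (*-congˡ (prodᶠ-⊗ (f ∘ Fin.suc) (g ∘ Fin.suc))) (interchange _ _ _ _)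

  prodᶠ-pow-𝟙 : ∀ {m} (A : Fin m → Carrier) (a : Fin m) → prodᶠ (λ j → pow (A j) (𝟙 (a == j))) ≈ A a
  prodᶠ-pow-𝟙 {suc m} A 0F = ≈-trans (*-cong (*-identityʳ _) (prodᶠ-1 {m})) (*-identityʳ _)
  prodᶠ-pow-𝟙 {suc m} A (Fin.suc a) = ≈-trans (*-identityˡ _)
    (≈-trans (prodᶠ-cong (λ j → ≈-reflexive (cong (pow (A (Fin.suc j)) ∘ 𝟙) (suc==suc a j))))
             (prodᶠ-pow-𝟙 (A ∘ Fin.suc) a))

  prodᶠ-pow-𝟙+𝟙 : ∀ {m} (A : Fin m → Carrier) (a b : Fin m) →
    prodᶠ (λ j → pow (A j) (𝟙 (a == j) + 𝟙 (b == j))) ≈ A a ⊗ A b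
  prodᶠ-pow-𝟙+𝟙 A a b = begin
    prodᶠ (λ j → pow (A j) (𝟙 (a == j) + 𝟙 (b == j)))
      ≈⟨ prodᶠ-cong (λ j → pow-+ (A j) (𝟙 (a == j)) (𝟙 (b == j))) ⟩
    prodᶠ (λ j → pow (A j) (𝟙 (a == j)) ⊗ pow (A j) (𝟙 (b == j)))
      ≈⟨ prodᶠ-⊗ (λ j → pow (A j) (𝟙 (a == j))) (λ j → pow (A j) (𝟙 (b == j))) ⟩
    prodᶠ (λ j → pow (A j) (𝟙 (a == j))) ⊗ prodᶠ (λ j → pow (A j) (𝟙 (b == j)))
      ≈⟨ *-cong (prodᶠ-pow-𝟙 A a) (prodᶠ-pow-𝟙 A b) ⟩
    A a ⊗ A b
      ∎

urbanWeights≈clusterWeights : ∀ {c ℓ} (F : Field c ℓ) {n} (Q : Quiver n) (A : Fin n → Field.Carrier F)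
  (k k₁ k₂ k₃ k₄ : Fin n) (nz : ¬ Field._≈_ F (A k) (Field.0# F)) →
  (∀ j → Q j k ≡ 𝟙 (k₂ == j) + 𝟙 (k₄ == j)) → (∀ j → Q k j ≡ 𝟙 (k₁ == j) + 𝟙 (k₃ == j)) →
  ∀ i → Field._≈_ F (urbanWeights F A k k₁ k₂ k₃ k₄ nz i) (clusterWeights F Q A k nz i)
urbanWeights≈clusterWeights F Q A k k₁ k₂ k₃ k₄ nz into from i with i == k
... | false = Field.refl F
... | true = *-congʳ (≈-trans (+-comm _ _) (≈-sym (+-cong into-k from-k)))
  where
  open Field F using (_≈_; pow; prodᶠ; *-congʳ; +-comm; +-cong)
    renaming (_*_ to _⊗_; sym to ≈-sym; trans to ≈-trans; reflexive to ≈-reflexive)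
  open FieldProducts F using (prodᶠ-cong; prodᶠ-pow-𝟙+𝟙)
  into-k : prodᶠ (λ j → pow (A j) (Q j k)) ≈ A k₂ ⊗ A k₄
  into-k = ≈-trans (prodᶠ-cong (λ j → ≈-reflexive (cong (pow (A j)) (into j)))) (prodᶠ-pow-𝟙+𝟙 A k₂ k₄)
  from-k : prodᶠ (λ j → pow (A j) (Q k j)) ≈ A k₁ ⊗ A k₃
  from-k = ≈-trans (prodᶠ-cong (λ j → ≈-reflexive (cong (pow (A j)) (from j)))) (prodᶠ-pow-𝟙+𝟙 A k₁ k₃)

theorem3p4 : ∀ {c ℓ} (F : Field c ℓ) {n : ℕ}
    (G : BGraph n) (genus : Fin n → ℕ) → IsTorusGraph G genus →
    (A : Fin n → Field.Carrier F) (nonzero : ∀ i → ¬ (Field._≈_ F (A i) (Field.0# F))) →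
    (∀ i → quiver G i i ≡ 0) →
    (k : Fin n) (s₁ s₂ s₃ s₄ : Fin (BGraph.M G)) → IsQuadFace G genus k s₁ s₂ s₃ s₄ →
    across₁ G s₁ ≢ across₂ G s₂ → across₂ G s₂ ≢ across₃ G s₃ →
    across₃ G s₃ ≢ across₄ G s₄ → across₄ G s₄ ≢ across₁ G s₁ →
    (H : BGraph n) → ShrinkAll (urbanRenewal G k s₁ s₂ s₃ s₄) H →
    (∀ i j → quiver H i j ≡ mutateQuiver k (quiver G) i j)
    × (∀ i → Field._≈_ F
               (urbanWeights F A k (across₁ G s₁) (across₂ G s₂) (across₃ G s₃) (across₄ G s₄) (nonzero k) i)
               (clusterWeights F (quiver G) A k (nonzero k) i))
theorem3p4 F G genus torus A nonzero loops k s₁ s₂ s₃ s₄ quad k₁≢k₂ k₂≢k₃ k₃≢k₄ k₄≢k₁ H shrinks =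
  (λ i j → trans (quiver-cong (proj₁ shrunk) map′ (proj₂ shrunk) i j) (removeTwoCycles-mutation counts i j))
  , urbanWeights≈clusterWeights F (quiver G) A k _ _ _ _ (nonzero k)
      (removeTwoCycles-into counts) (removeTwoCycles-from counts)
  where
  open UrbanRenewal G k s₁ s₂ s₃ s₄ (torus⇒looplessMap G torus loops) quad k₁≢k₂ k₂≢k₃ k₃≢k₄ k₄≢k₁
    using (G′; map′; counts)
  shrunk : IsLooplessMap H × NetArrowsEq H G′
  shrunk = shrinkAll-preserves shrinks map′
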